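{- Let $G=(V,E)$ be a finite graph with $n=|V|\ge1$, and let $F(x)=n!\,P_G(x)$. For $k\ge 0$ let $A_k$ be the number of bijections $\pi:V\to\{1,\dots,n\}$ having exactly $k$ bad vertices. Then for every $k\ge 0$, $$A_k=\frac{F^{(k)}(-1)}{k!}.$$ In particular $A_0=\sigma(G)$, the number of successive vertex orderings of $G$.
   Context: For a bijection $\pi:V\to\{1,\dots,n\}$, a vertex $v$ is bad if $\pi(v)\ne1$ and $\pi(v)<\pi(u)$ for every neighbour $u$ of $v$. An ordering is successive if it has no bad vertex. For $I\subseteq V$ let $N(I)$ be the set of vertices adjacent to some vertex of $I$ and $a(I)=n-|I|-|N(I)|$. For independent sets $I$ (no two vertices adjacent) define $b(\varnothing)=1$ and $b(I)=\frac{1}{n-a(I)}\sum_{v\in I}b(I\setminus\{v\})$ for $I\ne\varnothing$, and $w(I)=\frac{a(I)}{n}b(I)$. The successive ordering polynomial is $P_G(x)=\sum_{I\ \text{independent}} w(I)\,x^{|I|}$. -}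

module Defs where

open import Data.Bool using (Bool; true; false; _∧_; _∨_; not; if_then_else_)
open import Data.Nat using (ℕ; zero; suc; _∸_; _≡ᵇ_; _<ᵇ_; _!)
open import Data.Nat.Properties using (_!≢0)

open import Data.Fin using (Fin; toℕ)
import Data.Fin as Fin
open import Data.Integer using (+_)
open import Data.List using (List; []; _∷_; [_]; _++_; map; foldr; concatMap; allFin; upTo; length; filterᵇ; zipWith)
open import Data.Vec using (Vec; lookup; tabulate; _[_]≔_)
import Data.Vec as Vec
open import Data.Rational using (ℚ; 0ℚ; 1ℚ; _+_; _*_; -_; _/_)
open import Relation.Binary.PropositionalEquality using (_≡_)

record Graph (n : ℕ) : Set where
  field
    adj        : Fin n → Fin n → Bool
    adj-sym    : ∀ u v → adj u v ≡ adj v u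
    adj-irrefl : ∀ v → adj v v ≡ false
open Graph public

allV : ∀ {n} → (Fin n → Bool) → Bool
allV {n} p = foldr (λ v r → p v ∧ r) true (allFin n)

anyV : ∀ {n} → (Fin n → Bool) → Bool
anyV {n} p = foldr (λ v r → p v ∨ r) false (allFin n)

countV : ∀ {n} → (Fin n → Bool) → ℕ
countV {n} p = length (filterᵇ p (allFin n))

sumℚ : List ℚ → ℚ
sumℚ = foldr _+_ 0ℚ

ℕtoℚ : ℕ → ℚ
ℕtoℚ m = + m / 1

-- 1/m for m ≥ 1 (only ever used with m ≥ 1; value at 0 is irrelevant)
inv : ℕ → ℚ
inv zero    = 0ℚ
inv (suc m) = + 1 / suc m

Subset : ℕ → Set
Subset n = Vec Bool n

allSubsets : (n : ℕ) → List (Subset n)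
allSubsets zero    = [ Vec.[] ]
allSubsets (suc n) = map (false Vec.∷_) (allSubsets n) ++ map (true Vec.∷_) (allSubsets n)

card : ∀ {n} → Subset n → ℕ
card I = countV (lookup I)

nbhd : ∀ {n} → Graph n → Subset n → Subset n
nbhd G I = tabulate (λ u → anyV (λ v → lookup I v ∧ adj G v u))

independent : ∀ {n} → Graph n → Subset n → Bool
independent G I = allV (λ u → allV (λ v → not (lookup I u ∧ lookup I v ∧ adj G u v)))

a : ∀ {n} → Graph n → Subset n → ℕ
a {n} G I = n ∸ card I ∸ card (nbhd G I)

bAux : ∀ {n} → Graph n → ℕ → Subset n → ℚ
bAux G zero    I = 1ℚ
bAux {n} G (suc f) I =
  inv (n ∸ a G I) * sumℚ (map (λ v → if lookup I v then bAux G f (I [ v ]≔ false) else 0ℚ) (allFin n))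

b : ∀ {n} → Graph n → Subset n → ℚ
b G I = bAux G (card I) I

w : ∀ {n} → Graph n → Subset n → ℚ
w {n} G I = (ℕtoℚ (a G I) * inv n) * b G I

-- Polynomials over ℚ as coefficient lists (constant term first)

Poly : Set
Poly = List ℚ

eval : Poly → ℚ → ℚ
eval p x = foldr (λ c r → c + x * r) 0ℚ p

deriv : Poly → Poly
deriv []       = []
deriv (_ ∷ cs) = zipWith (λ i c → ℕtoℚ (suc i) * c) (upTo (length cs)) cs

derivN : ℕ → Poly → Poly
derivN zero    p = p
derivN (suc k) p = deriv (derivN k p)

P : ∀ {n} → Graph n → Poly
P {n} G = map (λ j → sumℚ (map (λ I → if independent G I ∧ (card I ≡ᵇ j) then w G I else 0ℚ)
                                (allSubsets n)))
              (upTo (suc n))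

F : ∀ {n} → Graph n → Poly
F {n} G = map (λ c → ℕtoℚ (n !) * c) (P G)

rhs : ∀ {n} → Graph n → ℕ → ℚ
rhs G k = eval (derivN k (F G)) (- 1ℚ) * ((+ 1 / (k !)) {{k !≢0}})

-- Orderings π : V → {1..n}, encoded as π : Fin n → Fin n (value zero = position 1)

consF : ∀ {n m} → Fin m → (Fin n → Fin m) → Fin (suc n) → Fin m
consF i f Fin.zero    = i
consF i f (Fin.suc x) = f x

allFuns : (n m : ℕ) → List (Fin n → Fin m)
allFuns zero    m = [ (λ ()) ]
allFuns (suc n) m = concatMap (λ f → map (λ i → consF i f) (allFin m)) (allFuns n m)

eqF : ∀ {n} → Fin n → Fin n → Bool
eqF i j = toℕ i ≡ᵇ toℕ j

isBijection : ∀ {n} → (Fin n → Fin n) → Bool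
isBijection π = allV (λ u → allV (λ v → not (eqF (π u) (π v)) ∨ eqF u v))
              ∧ allV (λ y → anyV (λ x → eqF (π x) y))

bad : ∀ {n} → Graph n → (Fin n → Fin n) → Fin n → Bool
bad G π v = not (toℕ (π v) ≡ᵇ 0) ∧ allV (λ u → not (adj G v u) ∨ (toℕ (π v) <ᵇ toℕ (π u)))

numBad : ∀ {n} → Graph n → (Fin n → Fin n) → ℕ
numBad G π = countV (bad G π)

successive : ∀ {n} → Graph n → (Fin n → Fin n) → Bool
successive G π = allV (λ v → not (bad G π v))

A : ∀ {n} → Graph n → ℕ → ℕ
A {n} G k = length (filterᵇ (λ π → isBijection π ∧ (numBad G π ≡ᵇ k)) (allFuns n n))

σ : ∀ {n} → Graph n → ℕ
σ {n} G = length (filterᵇ (λ π → isBijection π ∧ successive G π) (allFuns n n))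

-- For an independent set I, inversion π ↦ π⁻¹ turns the orderings in which every vertex of I is
-- bad into the vertex sequences that start outside I and list each vertex of I before all of
-- its neighbours.  Classify such sequences of a set R ⊇ N(I ∩ R) by their first vertex x:
-- either x ∈ I ∩ R, which is the recursion defining b, or x is one of the
-- |R| - |I ∩ R| - |N(I ∩ R)| vertices of R outside I ∩ R and its neighbourhood; so there are
-- |R|! b(I ∩ R) of them.  On the whole vertex set the first vertex must avoid I ∪ N(I), which
-- leaves a(I) (n-1)! b(I) = n! w(I) orderings with I ⊆ bad(π).  No two adjacent vertices are
-- both bad, so summing over all I gives F(y) = Σ_π (1 + y)^|bad(π)|, whose Taylor coefficients
-- at y = -1 count the orderings by their number of bad vertices.
module Submission where

open import Algebra.Bundles using (CommutativeSemiring; CommutativeRing)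
import Algebra.Properties.CommutativeSemigroup as CommutativeSemigroup
open import Data.Bool using (Bool; true; false; _∧_; _∨_; not; if_then_else_; T)
import Data.Bool.Properties as Bool
open import Data.Bool.Properties using (T-∧; T-∨)
open import Data.Empty using (⊥; ⊥-elim)
open import Data.Fin using (Fin; zero; suc; toℕ; _<_)
import Data.Fin.Properties as Fin
open import Data.Fin.Subset using (_∩_; ⊤)
import Data.Integer as ℤ
import Data.Integer.Properties as ℤ
open import Data.List
  using (List; []; _∷_; _++_; map; foldr; concatMap; allFin; upTo; applyUpTo; length; filterᵇ; findᵇ; zipWith)
import Data.List.Membership.Propositional as List
open import Data.List.Membership.Propositional.Properties using (∈-allFin)
import Data.List.Properties as List
open import Data.List.Relation.Unary.Any using (here; there)
open import Data.Maybe using (just; nothing; fromMaybe)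
open import Data.Nat as ℕ using (ℕ; zero; suc; _!; _≤_)
open import Data.Nat.Combinatorics using (_C_; nCk+nC[k+1]≡[n+1]C[k+1]; nC1≡n)
open import Data.Nat.Coprimality as Coprime using (1-coprimeTo)
import Data.Nat.Properties as ℕ
open import Data.Nat.Solver using () renaming (module +-*-Solver to ℕ-Solver)
open import Data.Product as Product using (_×_; _,_; proj₁; proj₂; ∃)
import Data.Rational.Properties as ℚ
open import Data.Rational.Solver using (module +-*-Solver)
open import Data.Sum using (_⊎_; inj₁; inj₂)
open import Data.Vec using (_∷_; []; lookup; _[_]≔_)
import Data.Vec.Properties as Vec
open import Function using (_∘_; _⇔_; Equivalence; mk⇔)
open import Function.Definitions using (Injective; StrictlySurjective; StrictlyInverseˡ; StrictlyInverseʳ)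
open import Relation.Nullary using (¬_; yes; no)
open import Relation.Binary.PropositionalEquality as ≡
  using (_≡_; _≢_; refl; sym; trans; cong; cong₂; subst; subst₂; _≗_; module ≡-Reasoning)

open import Defs

module ListSum {c ℓ} (R : CommutativeSemiring c ℓ) where

  open CommutativeSemiring R
    using (Carrier; _≈_; _+_; _*_; 0#; 1#; +-cong; +-congˡ; +-identityˡ; +-assoc; +-commutativeSemigroup;
           *-comm; *-identityˡ; zeroˡ; zeroʳ; distribˡ)
    renaming (refl to ≈-refl; sym to ≈-sym; trans to ≈-trans)

  ∑ : {A : Set} → List A → (A → Carrier) → Carrier
  ∑ xs f = foldr _+_ 0# (map f xs)

  𝟙 : Bool → Carrier
  𝟙 b = if b then 1# else 0#

  module _ {A : Set} where

    ∑-cong : ∀ (xs : List A) {f g} → (∀ x → f x ≈ g x) → ∑ xs f ≈ ∑ xs g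
    ∑-cong []       f≈g = ≈-refl
    ∑-cong (x ∷ xs) f≈g = +-cong (f≈g x) (∑-cong xs f≈g)

    ∑-++ : ∀ (xs ys : List A) f → ∑ (xs ++ ys) f ≈ ∑ xs f + ∑ ys f
    ∑-++ []       ys f = ≈-sym (+-identityˡ _)
    ∑-++ (x ∷ xs) ys f = ≈-trans (+-congˡ (∑-++ xs ys f)) (≈-sym (+-assoc _ _ _))

    ∑-map : ∀ {B : Set} (g : B → A) xs f → ∑ (map g xs) f ≡ ∑ xs (f ∘ g)
    ∑-map g xs f = ≡.cong (foldr _+_ 0#) (≡.sym (List.map-∘ xs))

    ∑-concatMap : ∀ {B : Set} (g : B → List A) xs f → ∑ (concatMap g xs) f ≈ ∑ xs (λ x → ∑ (g x) f)
    ∑-concatMap g []       f = ≈-refl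
    ∑-concatMap g (x ∷ xs) f = ≈-trans (∑-++ (g x) _ f) (+-congˡ (∑-concatMap g xs f))

    ∑-zero : ∀ (xs : List A) → ∑ xs (λ _ → 0#) ≈ 0#
    ∑-zero []       = ≈-refl
    ∑-zero (x ∷ xs) = ≈-trans (+-identityˡ _) (∑-zero xs)

    ∑-+ : ∀ (xs : List A) f g → ∑ xs (λ x → f x + g x) ≈ ∑ xs f + ∑ xs g
    ∑-+ []       f g = ≈-sym (+-identityˡ 0#)
    ∑-+ (x ∷ xs) f g = ≈-trans (+-congˡ (∑-+ xs f g)) (interchange _ _ _ _)
      where open CommutativeSemigroup +-commutativeSemigroup using (interchange)

    ∑-*ˡ : ∀ (xs : List A) c f → ∑ xs (λ x → c * f x) ≈ c * ∑ xs f
    ∑-*ˡ []       c f = ≈-sym (zeroʳ c)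
    ∑-*ˡ (x ∷ xs) c f = ≈-trans (+-congˡ (∑-*ˡ xs c f)) (≈-sym (distribˡ c _ _))

    ∑-*ʳ : ∀ (xs : List A) c f → ∑ xs (λ x → f x * c) ≈ ∑ xs f * c
    ∑-*ʳ xs c f = ≈-trans (∑-cong xs (λ x → *-comm (f x) c)) (≈-trans (∑-*ˡ xs c f) (*-comm c _))

  ∑-comm : ∀ {A B : Set} (xs : List A) (ys : List B) (f : A → B → Carrier) →
           ∑ xs (λ x → ∑ ys (f x)) ≈ ∑ ys (λ y → ∑ xs (λ x → f x y))
  ∑-comm []       ys f = ≈-sym (∑-zero ys)
  ∑-comm (x ∷ xs) ys f = ≈-trans (+-congˡ (∑-comm xs ys f)) (≈-sym (∑-+ ys (f x) (λ y → ∑ xs (λ x′ → f x′ y))))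

  ∑-allFin-suc : ∀ {n} (f : Fin (suc n) → Carrier) → ∑ (allFin (suc n)) f ≡ f zero + ∑ (allFin n) (f ∘ suc)
  ∑-allFin-suc {n} f = ≡.cong (λ xs → f zero + foldr _+_ 0# xs)
    (≡.trans (List.map-tabulate suc f) (≡.sym (List.map-tabulate (λ i → i) (f ∘ suc))))

  ∑-upTo-suc : ∀ m (f : ℕ → Carrier) → ∑ (upTo (suc m)) f ≡ f 0 + ∑ (upTo m) (f ∘ suc)
  ∑-upTo-suc m f =
    ≡.cong (f 0 +_) (≡.trans (≡.cong (λ xs → ∑ xs f) (≡.sym (List.map-upTo suc m))) (∑-map suc (upTo m) f))

  𝟙-∧ : ∀ x y → 𝟙 (x ∧ y) ≈ 𝟙 x * 𝟙 y
  𝟙-∧ true  y = ≈-sym (*-identityˡ _)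
  𝟙-∧ false y = ≈-sym (zeroˡ _)

  if-then-0 : ∀ b x → (if b then x else 0#) ≈ 𝟙 b * x
  if-then-0 true  x = ≈-sym (*-identityˡ x)
  if-then-0 false x = ≈-sym (zeroˡ x)

-- Imported only here: ListSum uses the same operator names for its semiring.
open import Data.Rational using (ℚ; mkℚ; 0ℚ; 1ℚ; _+_; _*_; -_; _/_)

module ℕ* = CommutativeSemigroup ℕ.*-commutativeSemigroup
module ℚ* = CommutativeSemigroup (CommutativeRing.*-commutativeSemigroup ℚ.+-*-commutativeRing)

module ℕΣ = ListSum ℕ.+-*-commutativeSemiring
module ℚΣ = ListSum (CommutativeRing.commutativeSemiring ℚ.+-*-commutativeRing)

T⇔→≡ : ∀ {x y} → T x ⇔ T y → x ≡ y
T⇔→≡ {false} {false} _ = refl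
T⇔→≡ {false} {true}  h = ⊥-elim (Equivalence.from h _)
T⇔→≡ {true}  {false} h = ⊥-elim (Equivalence.to h _)
T⇔→≡ {true}  {true}  _ = refl

∧⁺ : ∀ {x y} → T x → T y → T (x ∧ y)
∧⁺ tx ty = Equivalence.from T-∧ (tx , ty)

∧⁻ : ∀ {x y} → T (x ∧ y) → T x × T y
∧⁻ = Equivalence.to T-∧

not⁺ : ∀ {x} → ¬ T x → T (not x)
not⁺ {false} _  = _
not⁺ {true}  ¬x = ¬x _

not⁻ : ∀ {x} → T (not x) → ¬ T x
not⁻ {false} _ ()

impl⁺ : ∀ {x y} → (T x → T y) → T (not x ∨ y)
impl⁺ {false} _ = _
impl⁺ {true}  h = h _

impl⁻ : ∀ {x y} → T (not x ∨ y) → T x → T y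
impl⁻ {true} h _ = h

allV-suc : ∀ {n} (p : Fin (suc n) → Bool) → allV p ≡ p zero ∧ allV (p ∘ suc)
allV-suc {n} p = cong (p zero ∧_)
  (trans (cong (foldr step true) (sym (List.map-tabulate (λ i → i) suc))) (List.foldr-map step suc true (allFin n)))
  where
  step : Fin (suc n) → Bool → Bool
  step v r = p v ∧ r

anyV-suc : ∀ {n} (p : Fin (suc n) → Bool) → anyV p ≡ p zero ∨ anyV (p ∘ suc)
anyV-suc {n} p = cong (p zero ∨_)
  (trans (cong (foldr step false) (sym (List.map-tabulate (λ i → i) suc))) (List.foldr-map step suc false (allFin n)))
  where
  step : Fin (suc n) → Bool → Bool
  step v r = p v ∨ r

allV⁺ : ∀ {n} (p : Fin n → Bool) → (∀ v → T (p v)) → T (allV p)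
allV⁺ {zero}  p h = _
allV⁺ {suc n} p h = subst T (sym (allV-suc p)) (∧⁺ (h zero) (allV⁺ (p ∘ suc) (h ∘ suc)))

allV⁻ : ∀ {n} (p : Fin n → Bool) → T (allV p) → ∀ v → T (p v)
allV⁻ {suc n} p h v with ∧⁻ {p zero} (subst T (allV-suc p) h) | v
... | h₀ , _  | zero  = h₀
... | _  , hₛ | suc v = allV⁻ (p ∘ suc) hₛ v

anyV⁺ : ∀ {n} (p : Fin n → Bool) v → T (p v) → T (anyV p)
anyV⁺ {suc n} p v h = subst T (sym (anyV-suc p)) (Equivalence.from T-∨ (witness v h))
  where
  witness : ∀ v → T (p v) → T (p zero) ⊎ T (anyV (p ∘ suc))
  witness zero    h = inj₁ h
  witness (suc v) h = inj₂ (anyV⁺ (p ∘ suc) v h)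

anyV⁻ : ∀ {n} (p : Fin n → Bool) → T (anyV p) → ∃ λ v → T (p v)
anyV⁻ {suc n} p h with Equivalence.to (T-∨ {p zero}) (subst T (anyV-suc p) h)
... | inj₁ h₀ = zero , h₀
... | inj₂ hₛ = let (v , pv) = anyV⁻ (p ∘ suc) hₛ in suc v , pv

allV-cong : ∀ {n} {p q : Fin n → Bool} → p ≗ q → allV p ≡ allV q
allV-cong {p = p} {q} p≗q = T⇔→≡ (mk⇔ (λ h → allV⁺ q (λ v → subst T (p≗q v) (allV⁻ p h v)))
                                      (λ h → allV⁺ p (λ v → subst T (sym (p≗q v)) (allV⁻ q h v))))

anyV-cong : ∀ {n} {p q : Fin n → Bool} → p ≗ q → anyV p ≡ anyV q
anyV-cong {p = p} {q} p≗q = T⇔→≡ (mk⇔ (move p q p≗q) (move q p (sym ∘ p≗q)))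
  where
  move : ∀ p q → p ≗ q → T (anyV p) → T (anyV q)
  move p q p≗q h = let (v , pv) = anyV⁻ p h in anyV⁺ q v (subst T (p≗q v) pv)

eqF⁺ : ∀ {n} {i j : Fin n} → i ≡ j → T (eqF i j)
eqF⁺ {i = i} refl = ℕ.≡⇒≡ᵇ (toℕ i) (toℕ i) refl

eqF⁻ : ∀ {n} {i j : Fin n} → T (eqF i j) → i ≡ j
eqF⁻ {i = i} {j} h = Fin.toℕ-injective (ℕ.≡ᵇ⇒≡ (toℕ i) (toℕ j) h)

length-filterᵇ : ∀ {A : Set} (p : A → Bool) xs → length (filterᵇ p xs) ≡ ℕΣ.∑ xs (ℕΣ.𝟙 ∘ p)
length-filterᵇ p []       = refl
length-filterᵇ p (x ∷ xs) with p x
... | true  = cong suc (length-filterᵇ p xs)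
... | false = length-filterᵇ p xs

countV-suc : ∀ {n} (p : Fin (suc n) → Bool) → countV p ≡ ℕΣ.𝟙 (p zero) ℕ.+ countV (p ∘ suc)
countV-suc {n} p = begin
  countV p                                             ≡⟨ length-filterᵇ p (allFin (suc n)) ⟩
  ℕΣ.∑ (allFin (suc n)) (ℕΣ.𝟙 ∘ p)                     ≡⟨ ℕΣ.∑-allFin-suc (ℕΣ.𝟙 ∘ p) ⟩
  ℕΣ.𝟙 (p zero) ℕ.+ ℕΣ.∑ (allFin n) (ℕΣ.𝟙 ∘ p ∘ suc)
    ≡⟨ cong (ℕΣ.𝟙 (p zero) ℕ.+_) (length-filterᵇ (p ∘ suc) (allFin n)) ⟨
  ℕΣ.𝟙 (p zero) ℕ.+ countV (p ∘ suc)                   ∎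
  where open ≡-Reasoning

countV-≤ : ∀ {n} (p : Fin n → Bool) → countV p ℕ.≤ n
countV-≤ {zero}  p = ℕ.z≤n
countV-≤ {suc n} p with p zero | countV-suc p
... | true  | eq = ℕ.≤-trans (ℕ.≤-reflexive eq) (ℕ.s≤s (countV-≤ (p ∘ suc)))
... | false | eq = ℕ.≤-trans (ℕ.≤-reflexive eq) (ℕ.m≤n⇒m≤1+n (countV-≤ (p ∘ suc)))

countV-+ : ∀ {n} (p q r : Fin n → Bool) → (∀ v → ℕΣ.𝟙 (p v) ≡ ℕΣ.𝟙 (q v) ℕ.+ ℕΣ.𝟙 (r v)) →
           countV p ≡ countV q ℕ.+ countV r
countV-+ {n} p q r split = begin
  countV p                                          ≡⟨ length-filterᵇ p (allFin n) ⟩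
  ℕΣ.∑ (allFin n) (ℕΣ.𝟙 ∘ p)                        ≡⟨ ℕΣ.∑-cong (allFin n) split ⟩
  ℕΣ.∑ (allFin n) (λ v → ℕΣ.𝟙 (q v) ℕ.+ ℕΣ.𝟙 (r v))   ≡⟨ ℕΣ.∑-+ (allFin n) _ _ ⟩
  ℕΣ.∑ (allFin n) (ℕΣ.𝟙 ∘ q) ℕ.+ ℕΣ.∑ (allFin n) (ℕΣ.𝟙 ∘ r)
    ≡⟨ cong₂ ℕ._+_ (length-filterᵇ q (allFin n)) (length-filterᵇ r (allFin n)) ⟨
  countV q ℕ.+ countV r                               ∎
  where open ≡-Reasoning

countV≡0⁻ : ∀ {n} (p : Fin n → Bool) → countV p ≡ 0 → ∀ v → ¬ T (p v)
countV≡0⁻ {suc n} p none zero with p zero | trans (sym none) (countV-suc p)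
... | false | _ = λ ()
countV≡0⁻ {suc n} p none (suc v) with p zero | trans (sym none) (countV-suc p)
... | false | eq = countV≡0⁻ (p ∘ suc) (sym eq) v

countV≡0⁺ : ∀ {n} (p : Fin n → Bool) → (∀ v → ¬ T (p v)) → countV p ≡ 0
countV≡0⁺ {zero}  p none = refl
countV≡0⁺ {suc n} p none with p zero in p₀ | countV-suc p
... | true  | _  = ⊥-elim (none zero (subst T (sym p₀) _))
... | false | eq = trans eq (countV≡0⁺ (p ∘ suc) (none ∘ suc))

infix 4 _∈_ _∉_

_∈_ : ∀ {n} → Fin n → Subset n → Set
v ∈ R = T (lookup R v)

_∉_ : ∀ {n} → Fin n → Subset n → Set
v ∉ R = ¬ v ∈ R

_∖_ : ∀ {n} → Subset n → Fin n → Subset n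
R ∖ x = R [ x ]≔ false

x∉R∖x : ∀ {n} (R : Subset n) x → x ∉ R ∖ x
x∉R∖x R x = subst T (Vec.lookup∘update x R false)

lookup-∖ : ∀ {n} (R : Subset n) {x v} → v ≢ x → lookup (R ∖ x) v ≡ lookup R v
lookup-∖ R v≢x = Vec.lookup∘update′ v≢x R false

∈-∖⁺ : ∀ {n} {R : Subset n} {x v} → v ∈ R → v ≢ x → v ∈ R ∖ x
∈-∖⁺ {R = R} v∈R v≢x = subst T (sym (lookup-∖ R v≢x)) v∈R

∈-∖⁻ : ∀ {n} {R : Subset n} {x v} → v ∈ R ∖ x → v ∈ R × v ≢ x
∈-∖⁻ {R = R} {x} {v} v∈R∖x with v Fin.≟ x
... | yes refl = ⊥-elim (x∉R∖x R x v∈R∖x)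
... | no v≢x  = subst T (lookup-∖ R v≢x) v∈R∖x , v≢x

∖-∉ : ∀ {n} (R : Subset n) {x} → x ∉ R → R ∖ x ≡ R
∖-∉ (false ∷ R) {zero}  x∉R = refl
∖-∉ (true  ∷ R) {zero}  x∉R = ⊥-elim (x∉R _)
∖-∉ (b ∷ R)     {suc x} x∉R = cong (b ∷_) (∖-∉ R x∉R)

lookup-∩ : ∀ {n} (J R : Subset n) v → lookup (J ∩ R) v ≡ lookup J v ∧ lookup R v
lookup-∩ J R v = Vec.lookup-zipWith _∧_ v J R

lookup-⊤ : ∀ {n} (v : Fin n) → lookup ⊤ v ≡ true
lookup-⊤ v = Vec.lookup-replicate v true

∈⊤ : ∀ {n} (v : Fin n) → v ∈ ⊤
∈⊤ v = subst T (sym (lookup-⊤ v)) _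

∈-∩⁺ : ∀ {n} {J R : Subset n} {v} → v ∈ J → v ∈ R → v ∈ J ∩ R
∈-∩⁺ {J = J} {R} {v} v∈J v∈R = subst T (sym (lookup-∩ J R v)) (∧⁺ v∈J v∈R)

∈-∩⁻ : ∀ {n} {J R : Subset n} {v} → v ∈ J ∩ R → v ∈ J × v ∈ R
∈-∩⁻ {J = J} {R} {v} v∈J∩R = ∧⁻ {lookup J v} (subst T (lookup-∩ J R v) v∈J∩R)

∩-⊤ : ∀ {n} (I : Subset n) → I ∩ ⊤ ≡ I
∩-⊤ []      = refl
∩-⊤ (i ∷ I) = cong₂ _∷_ (Bool.∧-identityʳ i) (∩-⊤ I)

∩-∖ : ∀ {n} (I R : Subset n) x → I ∩ (R ∖ x) ≡ (I ∩ R) ∖ x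
∩-∖ (i ∷ I) (r ∷ R) zero    = cong (_∷ I ∩ R) (Bool.∧-zeroʳ i)
∩-∖ (i ∷ I) (r ∷ R) (suc x) = cong (i ∧ r ∷_) (∩-∖ I R x)

card-∷ : ∀ {n} b (R : Subset n) → card (b ∷ R) ≡ ℕΣ.𝟙 b ℕ.+ card R
card-∷ b R = countV-suc (lookup (b ∷ R))

card-⊤ : ∀ {n} → card (⊤ {n}) ≡ n
card-⊤ {zero}  = refl
card-⊤ {suc n} = trans (card-∷ true (⊤ {n})) (cong suc (card-⊤ {n}))

card-∖ : ∀ {n} (R : Subset n) {x} → x ∈ R → card R ≡ suc (card (R ∖ x))
card-∖ (true ∷ R) {zero} _ = trans (card-∷ true R) (cong suc (sym (card-∷ false R)))
card-∖ (b ∷ R) {suc x} x∈R = begin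
  card (b ∷ R)                        ≡⟨ card-∷ b R ⟩
  ℕΣ.𝟙 b ℕ.+ card R                   ≡⟨ cong (ℕΣ.𝟙 b ℕ.+_) (card-∖ R x∈R) ⟩
  ℕΣ.𝟙 b ℕ.+ suc (card (R ∖ x))       ≡⟨ ℕ.+-suc (ℕΣ.𝟙 b) _ ⟩
  suc (ℕΣ.𝟙 b ℕ.+ card (R ∖ x))       ≡⟨ cong suc (card-∷ b (R ∖ x)) ⟨
  suc (card (b ∷ R ∖ x))              ∎
  where open ≡-Reasoning

card≡0⁻ : ∀ {n} (R : Subset n) → card R ≡ 0 → ∀ v → v ∉ R
card≡0⁻ R = countV≡0⁻ (lookup R)

ℕtoℚ≡mkℚ : ∀ m → ℕtoℚ m ≡ mkℚ (ℤ.+ m) 0 (Coprime.sym (1-coprimeTo m))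
ℕtoℚ≡mkℚ m = ℚ.normalize-coprime (Coprime.sym (1-coprimeTo m))

ℕtoℚ-+ : ∀ m n → ℕtoℚ (m ℕ.+ n) ≡ ℕtoℚ m + ℕtoℚ n
ℕtoℚ-+ m n = sym (trans (cong₂ _+_ (ℕtoℚ≡mkℚ m) (ℕtoℚ≡mkℚ n))
  (cong (_/ 1) (cong₂ ℤ._+_ (ℤ.*-identityʳ (ℤ.+ m)) (ℤ.*-identityʳ (ℤ.+ n)))))

ℕtoℚ-* : ∀ m n → ℕtoℚ (m ℕ.* n) ≡ ℕtoℚ m * ℕtoℚ n
ℕtoℚ-* m n = sym (trans (cong₂ _*_ (ℕtoℚ≡mkℚ m) (ℕtoℚ≡mkℚ n)) (cong (_/ 1) (sym (ℤ.pos-* m n))))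

ℕtoℚ-𝟙 : ∀ b → ℕtoℚ (ℕΣ.𝟙 b) ≡ ℚΣ.𝟙 b
ℕtoℚ-𝟙 true  = refl
ℕtoℚ-𝟙 false = refl

ℕtoℚ-∑ : ∀ {A : Set} (xs : List A) f → ℕtoℚ (ℕΣ.∑ xs f) ≡ ℚΣ.∑ xs (ℕtoℚ ∘ f)
ℕtoℚ-∑ []       f = refl
ℕtoℚ-∑ (x ∷ xs) f = trans (ℕtoℚ-+ (f x) _) (cong (ℕtoℚ (f x) +_) (ℕtoℚ-∑ xs f))

ℕtoℚ-length-filterᵇ : ∀ {A : Set} (p : A → Bool) xs → ℕtoℚ (length (filterᵇ p xs)) ≡ ℚΣ.∑ xs (ℚΣ.𝟙 ∘ p)
ℕtoℚ-length-filterᵇ p xs =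
  trans (cong ℕtoℚ (length-filterᵇ p xs)) (trans (ℕtoℚ-∑ xs (ℕΣ.𝟙 ∘ p)) (ℚΣ.∑-cong xs (ℕtoℚ-𝟙 ∘ p)))

ℕtoℚ*1/ : ∀ m .{{_ : ℕ.NonZero m}} → ℕtoℚ m * (ℤ.+ 1 / m) ≡ 1ℚ
ℕtoℚ*1/ (suc m) = trans (cong₂ _*_ (ℕtoℚ≡mkℚ (suc m)) (ℚ.normalize-coprime (1-coprimeTo (suc m))))
  (ℚ.*-inverseʳ (mkℚ (ℤ.+ suc m) 0 (Coprime.sym (1-coprimeTo (suc m)))))

ℕtoℚ*inv : ∀ m → ℕtoℚ (suc m) * inv (suc m) ≡ 1ℚ
ℕtoℚ*inv m = ℕtoℚ*1/ (suc m)

open ℚΣ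

𝟙-cong : ∀ {x y} → (T x → T y) → (T y → T x) → 𝟙 x ≡ 𝟙 y
𝟙-cong x⇒y y⇒x = cong 𝟙 (T⇔→≡ (mk⇔ x⇒y y⇒x))

𝟙-*-cong : ∀ c {p q} → (T c → p ≡ q) → 𝟙 c * p ≡ 𝟙 c * q
𝟙-*-cong true  p≡q = cong (1ℚ *_) (p≡q _)
𝟙-*-cong false {p} {q} _ = trans (ℚ.*-zeroˡ p) (sym (ℚ.*-zeroˡ q))

∑-eqF : ∀ {m} (j : Fin m) (x : ℚ) → ∑ (allFin m) (λ i → 𝟙 (eqF i j) * x) ≡ x
∑-eqF {suc m} zero x = begin
  ∑ (allFin (suc m)) (λ i → 𝟙 (eqF i zero) * x)  ≡⟨ ∑-allFin-suc {m} (λ i → 𝟙 (eqF i zero) * x) ⟩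
  1ℚ * x + ∑ (allFin m) (λ _ → 0ℚ * x)
    ≡⟨ cong₂ _+_ (ℚ.*-identityˡ x) (∑-cong (allFin m) (λ _ → ℚ.*-zeroˡ x)) ⟩
  x + ∑ (allFin m) (λ _ → 0ℚ)                     ≡⟨ cong (x +_) (∑-zero (allFin m)) ⟩
  x + 0ℚ                                          ≡⟨ ℚ.+-identityʳ x ⟩
  x                                               ∎
  where open ≡-Reasoning
∑-eqF {suc m} (suc j) x = trans (∑-allFin-suc {m} (λ i → 𝟙 (eqF i (suc j)) * x))
  (trans (cong (_+ ∑ (allFin m) (λ i → 𝟙 (eqF i j) * x)) (ℚ.*-zeroˡ x)) (trans (ℚ.+-identityˡ _) (∑-eqF j x)))

∑-allFuns-suc : ∀ r m (h : (Fin (suc r) → Fin m) → ℚ) →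
                ∑ (allFuns (suc r) m) h ≡ ∑ (allFuns r m) (λ f → ∑ (allFin m) (λ i → h (consF i f)))
∑-allFuns-suc r m h = trans (∑-concatMap _ (allFuns r m) h)
  (∑-cong (allFuns r m) (λ f → ∑-map (λ i → consF i f) (allFin m) h))

infix 4 _≐_

_≐_ : ∀ {r m} → (Fin r → Fin m) → (Fin r → Fin m) → Bool
f ≐ g = allV (λ v → eqF (f v) (g v))

≐⁺ : ∀ {r m} {f g : Fin r → Fin m} → f ≗ g → T (f ≐ g)
≐⁺ f≗g = allV⁺ _ (λ v → eqF⁺ (f≗g v))

≐⁻ : ∀ {r m} (f g : Fin r → Fin m) → T (f ≐ g) → f ≗ g
≐⁻ f g h v = eqF⁻ (allV⁻ (λ v → eqF (f v) (g v)) h v)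

∑-allFuns-≐ : ∀ r m (g : Fin r → Fin m) → ∑ (allFuns r m) (λ f → 𝟙 (f ≐ g)) ≡ 1ℚ
∑-allFuns-≐ zero    m g = ℚ.+-identityʳ 1ℚ
∑-allFuns-≐ (suc r) m g = begin
  ∑ (allFuns (suc r) m) (λ f → 𝟙 (f ≐ g))
    ≡⟨ ∑-allFuns-suc r m _ ⟩
  ∑ (allFuns r m) (λ f → ∑ (allFin m) (λ i → 𝟙 (consF i f ≐ g)))
    ≡⟨ ∑-cong (allFuns r m) (λ f → ∑-cong (allFin m) (λ i → cons≐ i f)) ⟩
  ∑ (allFuns r m) (λ f → ∑ (allFin m) (λ i → 𝟙 (eqF i (g zero)) * 𝟙 (f ≐ g ∘ suc)))
    ≡⟨ ∑-cong (allFuns r m) (λ f → ∑-eqF (g zero) (𝟙 (f ≐ g ∘ suc))) ⟩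
  ∑ (allFuns r m) (λ f → 𝟙 (f ≐ g ∘ suc))
    ≡⟨ ∑-allFuns-≐ r m (g ∘ suc) ⟩
  1ℚ ∎
  where
  open ≡-Reasoning
  cons≐ : ∀ i f → 𝟙 (consF i f ≐ g) ≡ 𝟙 (eqF i (g zero)) * 𝟙 (f ≐ g ∘ suc)
  cons≐ i f = trans (cong 𝟙 (allV-suc (λ v → eqF (consF i f v) (g v)))) (𝟙-∧ (eqF i (g zero)) (f ≐ g ∘ suc))

-- Without function extensionality, maps between sets of functions are inverse only up to ≗;
-- as allFuns lists every function exactly once up to ≗, such maps still preserve counts.
record Correspondence {r m} (P Q : (Fin r → Fin m) → Bool) : Set where
  field
    to        : (Fin r → Fin m) → (Fin r → Fin m)
    from      : (Fin r → Fin m) → (Fin r → Fin m)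
    to-cong   : ∀ {f g} → f ≗ g → to f ≗ to g
    from-cong : ∀ {f g} → f ≗ g → from f ≗ from g
    P-cong    : ∀ {f g} → f ≗ g → P f ≡ P g
    Q-cong    : ∀ {f g} → f ≗ g → Q f ≡ Q g
    to-Q      : ∀ {f} → T (P f) → T (Q (to f))
    from-P    : ∀ {g} → T (Q g) → T (P (from g))
    from∘to   : ∀ {f} → T (P f) → from (to f) ≗ f
    to∘from   : ∀ {g} → T (Q g) → to (from g) ≗ g

module _ {r m} {P Q : (Fin r → Fin m) → Bool} (C : Correspondence P Q) where
  open Correspondence C

  private
    Fun : List (Fin r → Fin m)
    Fun = allFuns r m

    graph-swap : ∀ f g → Q g ∧ (f ≐ from g) ≡ P f ∧ (g ≐ to f)
    graph-swap f g = T⇔→≡ (mk⇔ forth back)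
      where
      forth : T (Q g ∧ (f ≐ from g)) → T (P f ∧ (g ≐ to f))
      forth h with ∧⁻ {Q g} h
      ... | Qg , f≐ = ∧⁺ (subst T (sym (P-cong f≗)) (from-P Qg))
                         (≐⁺ (λ v → trans (sym (to∘from Qg v)) (to-cong (λ u → sym (f≗ u)) v)))
        where
        f≗ : f ≗ from g
        f≗ = ≐⁻ f (from g) f≐
      back : T (P f ∧ (g ≐ to f)) → T (Q g ∧ (f ≐ from g))
      back h with ∧⁻ {P f} h
      ... | Pf , g≐ = ∧⁺ (subst T (sym (Q-cong g≗)) (to-Q Pf))
                         (≐⁺ (λ v → trans (sym (from∘to Pf v)) (from-cong (λ u → sym (g≗ u)) v)))
        where
        g≗ : g ≗ to f
        g≗ = ≐⁻ g (to f) g≐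

  count-correspondence : ∑ Fun (𝟙 ∘ P) ≡ ∑ Fun (𝟙 ∘ Q)
  count-correspondence = sym (begin
    ∑ Fun (λ g → 𝟙 (Q g))
      ≡⟨ ∑-cong Fun (λ g → sym (trans (cong (𝟙 (Q g) *_) (∑-allFuns-≐ r m (from g))) (ℚ.*-identityʳ _))) ⟩
    ∑ Fun (λ g → 𝟙 (Q g) * ∑ Fun (λ f → 𝟙 (f ≐ from g)))
      ≡⟨ ∑-cong Fun (λ g → sym (∑-*ˡ Fun (𝟙 (Q g)) _)) ⟩
    ∑ Fun (λ g → ∑ Fun (λ f → 𝟙 (Q g) * 𝟙 (f ≐ from g)))
      ≡⟨ ∑-comm Fun Fun _ ⟩
    ∑ Fun (λ f → ∑ Fun (λ g → 𝟙 (Q g) * 𝟙 (f ≐ from g)))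
      ≡⟨ ∑-cong Fun (λ f → ∑-cong Fun (λ g → swap f g)) ⟩
    ∑ Fun (λ f → ∑ Fun (λ g → 𝟙 (P f) * 𝟙 (g ≐ to f)))
      ≡⟨ ∑-cong Fun (λ f → trans (∑-*ˡ Fun (𝟙 (P f)) _) (cong (𝟙 (P f) *_) (∑-allFuns-≐ r m (to f)))) ⟩
    ∑ Fun (λ f → 𝟙 (P f) * 1ℚ)
      ≡⟨ ∑-cong Fun (λ f → ℚ.*-identityʳ _) ⟩
    ∑ Fun (λ f → 𝟙 (P f)) ∎)
    where
    open ≡-Reasoning
    swap : ∀ f g → 𝟙 (Q g) * 𝟙 (f ≐ from g) ≡ 𝟙 (P f) * 𝟙 (g ≐ to f)
    swap f g = trans (sym (𝟙-∧ (Q g) _)) (trans (cong 𝟙 (graph-swap f g)) (𝟙-∧ (P f) _))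

injectiveᵇ : ∀ {r m} → (Fin r → Fin m) → Bool
injectiveᵇ σ = allV (λ u → allV (λ v → not (eqF (σ u) (σ v)) ∨ eqF u v))

surjectiveᵇ : ∀ {r m} → (Fin r → Fin m) → Bool
surjectiveᵇ σ = allV (λ y → anyV (λ x → eqF (σ x) y))

injectiveᵇ⁺ : ∀ {r m} (σ : Fin r → Fin m) → Injective _≡_ _≡_ σ → T (injectiveᵇ σ)
injectiveᵇ⁺ σ inj =
  allV⁺ _ (λ u → allV⁺ (λ v → not (eqF (σ u) (σ v)) ∨ eqF u v) (λ v → impl⁺ (eqF⁺ ∘ inj ∘ eqF⁻)))

injectiveᵇ⁻ : ∀ {r m} (σ : Fin r → Fin m) → T (injectiveᵇ σ) → Injective _≡_ _≡_ σ
injectiveᵇ⁻ σ h {u} {v} eq =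
  eqF⁻ (impl⁻ (allV⁻ (λ v → not (eqF (σ u) (σ v)) ∨ eqF u v) (allV⁻ _ h u) v) (eqF⁺ eq))

surjectiveᵇ⁺ : ∀ {r m} (σ : Fin r → Fin m) → StrictlySurjective _≡_ σ → T (surjectiveᵇ σ)
surjectiveᵇ⁺ σ surj = allV⁺ _ (λ y → anyV⁺ _ (proj₁ (surj y)) (eqF⁺ (proj₂ (surj y))))

surjectiveᵇ⁻ : ∀ {r m} (σ : Fin r → Fin m) → T (surjectiveᵇ σ) → StrictlySurjective _≡_ σ
surjectiveᵇ⁻ σ h y = Product.map₂ eqF⁻ (anyV⁻ _ (allV⁻ _ h y))

injectiveᵇ-cong : ∀ {r m} {σ σ′ : Fin r → Fin m} → σ ≗ σ′ → injectiveᵇ σ ≡ injectiveᵇ σ′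
injectiveᵇ-cong σ≗σ′ =
  allV-cong (λ u → allV-cong (λ v → cong₂ (λ x y → not (eqF x y) ∨ eqF u v) (σ≗σ′ u) (σ≗σ′ v)))

surjectiveᵇ-cong : ∀ {r m} {σ σ′ : Fin r → Fin m} → σ ≗ σ′ → surjectiveᵇ σ ≡ surjectiveᵇ σ′
surjectiveᵇ-cong σ≗σ′ = allV-cong (λ y → anyV-cong (λ x → cong (λ z → eqF z y) (σ≗σ′ x)))

intoᵇ : ∀ {r n} → Subset n → (Fin r → Fin n) → Bool
intoᵇ R σ = allV (λ i → lookup R (σ i))

intoᵇ⁺ : ∀ {r n} {R : Subset n} (σ : Fin r → Fin n) → (∀ i → σ i ∈ R) → T (intoᵇ R σ)
intoᵇ⁺ σ into = allV⁺ _ into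

intoᵇ⁻ : ∀ {r n} {R : Subset n} (σ : Fin r → Fin n) → T (intoᵇ R σ) → ∀ i → σ i ∈ R
intoᵇ⁻ σ = allV⁻ _

ontoᵇ : ∀ {r n} → Subset n → (Fin r → Fin n) → Bool
ontoᵇ R σ = allV (λ v → not (lookup R v) ∨ anyV (λ i → eqF (σ i) v))

ontoᵇ⁺ : ∀ {r n} {R : Subset n} (σ : Fin r → Fin n) → (∀ {v} → v ∈ R → ∃ λ i → σ i ≡ v) → T (ontoᵇ R σ)
ontoᵇ⁺ {R = R} σ onto = allV⁺ (λ v → not (lookup R v) ∨ anyV (λ i → eqF (σ i) v))
  (λ v → impl⁺ (λ v∈R → let (i , σi≡v) = onto v∈R in anyV⁺ _ i (eqF⁺ σi≡v)))

ontoᵇ⁻ : ∀ {r n} {R : Subset n} (σ : Fin r → Fin n) → T (ontoᵇ R σ) → ∀ {v} → v ∈ R → ∃ λ i → σ i ≡ v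
ontoᵇ⁻ {R = R} σ h {v} v∈R =
  Product.map₂ eqF⁻ (anyV⁻ _ (impl⁻ (allV⁻ (λ v → not (lookup R v) ∨ anyV (λ i → eqF (σ i) v)) h v) v∈R))

isBijection⁺ : ∀ {n} (π : Fin n → Fin n) → Injective _≡_ _≡_ π → StrictlySurjective _≡_ π → T (isBijection π)
isBijection⁺ π inj surj = ∧⁺ (injectiveᵇ⁺ π inj) (surjectiveᵇ⁺ π surj)

isBijection⁻ : ∀ {n} (π : Fin n → Fin n) → T (isBijection π) → Injective _≡_ _≡_ π × StrictlySurjective _≡_ π
isBijection⁻ π h = let (inj , surj) = ∧⁻ {injectiveᵇ π} h in injectiveᵇ⁻ π inj , surjectiveᵇ⁻ π surj

isBijection-cong : ∀ {n} {π π′ : Fin n → Fin n} → π ≗ π′ → isBijection π ≡ isBijection π′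
isBijection-cong π≗π′ = cong₂ _∧_ (injectiveᵇ-cong π≗π′) (surjectiveᵇ-cong π≗π′)

intoᵇ-cong : ∀ {r n} (R : Subset n) {σ σ′ : Fin r → Fin n} → σ ≗ σ′ → intoᵇ R σ ≡ intoᵇ R σ′
intoᵇ-cong R σ≗σ′ = allV-cong (cong (lookup R) ∘ σ≗σ′)

ontoᵇ-cong : ∀ {r n} (R : Subset n) {σ σ′ : Fin r → Fin n} → σ ≗ σ′ → ontoᵇ R σ ≡ ontoᵇ R σ′
ontoᵇ-cong R σ≗σ′ = allV-cong (λ v → cong (not (lookup R v) ∨_) (anyV-cong (λ i → cong (λ z → eqF z v) (σ≗σ′ i))))

infix 4 _⊆ᵇ_

_⊆ᵇ_ : ∀ {n} → Subset n → (Fin n → Bool) → Bool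
I ⊆ᵇ p = allV (λ v → not (lookup I v) ∨ p v)

⊆ᵇ⁺ : ∀ {n} {I : Subset n} {p} → (∀ {v} → v ∈ I → T (p v)) → T (I ⊆ᵇ p)
⊆ᵇ⁺ {I = I} {p} I⊆p = allV⁺ (λ v → not (lookup I v) ∨ p v) (λ v → impl⁺ I⊆p)

⊆ᵇ⁻ : ∀ {n} {I : Subset n} {p} → T (I ⊆ᵇ p) → ∀ {v} → v ∈ I → T (p v)
⊆ᵇ⁻ {I = I} {p} h {v} = impl⁻ (allV⁻ (λ v → not (lookup I v) ∨ p v) h v)

module _ {A : Set} where

  findᵇ-cong : ∀ {p q : A → Bool} → p ≗ q → ∀ xs → findᵇ p xs ≡ findᵇ q xs
  findᵇ-cong p≗q []       = refl
  findᵇ-cong p≗q (x ∷ xs) = cong₂ (λ b r → if b then just x else r) (p≗q x) (findᵇ-cong p≗q xs)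

  findᵇ-just : ∀ (p : A → Bool) xs {x} → findᵇ p xs ≡ just x → T (p x)
  findᵇ-just p (y ∷ xs) found with p y in py
  findᵇ-just p (y ∷ xs) refl | true  = subst T (sym py) _
  findᵇ-just p (y ∷ xs) found | false = findᵇ-just p xs found

  findᵇ-nothing : ∀ (p : A → Bool) xs {x} → findᵇ p xs ≡ nothing → x List.∈ xs → ¬ T (p x)
  findᵇ-nothing p (y ∷ xs) none x∈ with p y in py
  findᵇ-nothing p (y ∷ xs) none (here refl)  | false = subst T py
  findᵇ-nothing p (y ∷ xs) none (there x∈xs) | false = findᵇ-nothing p xs none x∈xs

inverse : ∀ {n} → (Fin n → Fin n) → Fin n → Fin n
inverse {n} π y = fromMaybe y (findᵇ (λ x → eqF (π x) y) (allFin n))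

inverse-cong : ∀ {n} {π π′ : Fin n → Fin n} → π ≗ π′ → inverse π ≗ inverse π′
inverse-cong {n} π≗π′ y =
  cong (fromMaybe y) (findᵇ-cong (λ x → cong (λ z → eqF z y) (π≗π′ x)) (allFin n))

inverse-section : ∀ {n} {π : Fin n → Fin n} → StrictlySurjective _≡_ π → StrictlyInverseˡ _≡_ π (inverse π)
inverse-section {n} {π} surj y with findᵇ (λ x → eqF (π x) y) (allFin n) in found
... | just x  = eqF⁻ (findᵇ-just (λ x → eqF (π x) y) (allFin n) found)
... | nothing = ⊥-elim (findᵇ-nothing (λ x → eqF (π x) y) (allFin n) found (∈-allFin x) (eqF⁺ πx≡y))
  where
  x : Fin n
  x = proj₁ (surj y)
  πx≡y : π x ≡ y
  πx≡y = proj₂ (surj y)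

module _ {n} {π : Fin n → Fin n} (inj : Injective _≡_ _≡_ π) (surj : StrictlySurjective _≡_ π) where

  inverse-retraction : StrictlyInverseʳ _≡_ π (inverse π)
  inverse-retraction x = inj (inverse-section surj (π x))

  inverse-injective : Injective _≡_ _≡_ (inverse π)
  inverse-injective {y} {y′} eq = trans (sym (inverse-section surj y)) (trans (cong π eq) (inverse-section surj y′))

  inverse-surjective : StrictlySurjective _≡_ (inverse π)
  inverse-surjective x = π x , inverse-retraction x

  inverse-involutive : inverse (inverse π) ≗ π
  inverse-involutive x = inverse-injective (trans (inverse-section inverse-surjective x) (sym (inverse-retraction x)))

-- Independent sets and the weights b

𝟙-partition : ∀ r j m → (T j → T r) → (T m → T r) → ℕΣ.𝟙 r ≡ ℕΣ.𝟙 (j ∨ m) ℕ.+ ℕΣ.𝟙 (r ∧ not (j ∨ m))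
𝟙-partition true  true  _     _   _   = refl
𝟙-partition true  false true  _   _   = refl
𝟙-partition true  false false _   _   = refl
𝟙-partition false true  _     j⇒r _   = ⊥-elim (j⇒r _)
𝟙-partition false false true  _   m⇒r = ⊥-elim (m⇒r _)
𝟙-partition false false false _   _   = refl

𝟙-∨-disjoint : ∀ j m → (T j → ¬ T m) → ℕΣ.𝟙 (j ∨ m) ≡ ℕΣ.𝟙 j ℕ.+ ℕΣ.𝟙 m
𝟙-∨-disjoint true  true  disj = ⊥-elim (disj _ _)
𝟙-∨-disjoint true  false _    = refl
𝟙-∨-disjoint false m     _    = refl

module _ {n} (G : Graph n) where

  Independent : Subset n → Set
  Independent J = ∀ {u v} → u ∈ J → v ∈ J → ¬ T (adj G u v)

  independent⁺ : ∀ {J} → Independent J → T (independent G J)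
  independent⁺ {J} indep = allV⁺ _ (λ u → allV⁺ _ (λ v → not⁺ (λ h → uv-edge u v (∧⁻ h))))
    where
    uv-edge : ∀ u v → T (lookup J u) × T (lookup J v ∧ adj G u v) → ⊥
    uv-edge u v (u∈J , h) = indep u∈J (proj₁ (∧⁻ {lookup J v} h)) (proj₂ (∧⁻ {lookup J v} h))

  independent⁻ : ∀ {J} → T (independent G J) → Independent J
  independent⁻ {J} h {u} {v} u∈J v∈J uv =
    not⁻ (allV⁻ _ (allV⁻ _ h u) v) (∧⁺ u∈J (∧⁺ {lookup J v} v∈J uv))

  ∈-nbhd⁺ : ∀ {J v x} → v ∈ J → T (adj G v x) → x ∈ nbhd G J
  ∈-nbhd⁺ {J} {v} {x} v∈J vx = subst T (sym (Vec.lookup∘tabulate _ x)) (anyV⁺ _ v (∧⁺ {lookup J v} v∈J vx))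

  ∈-nbhd⁻ : ∀ {J x} → x ∈ nbhd G J → ∃ λ v → v ∈ J × T (adj G v x)
  ∈-nbhd⁻ {J} {x} h = Product.map₂ (∧⁻ {lookup J _}) (anyV⁻ _ (subst T (Vec.lookup∘tabulate _ x) h))

  nbhd-disjoint : ∀ {J x} → Independent J → x ∈ nbhd G J → x ∉ J
  nbhd-disjoint {J} indep x∈N x∈J with ∈-nbhd⁻ {J} x∈N
  ... | v , v∈J , vx = indep v∈J x∈J vx

  free : Subset n → Subset n → Fin n → Bool
  free R J x = lookup R x ∧ not (lookup J x ∨ lookup (nbhd G J) x)

  card-partition : ∀ {R J} → (∀ {v} → v ∈ J → v ∈ R) → (∀ {v} → v ∈ nbhd G J → v ∈ R) → Independent J →
                   card R ≡ (card J ℕ.+ card (nbhd G J)) ℕ.+ countV (free R J)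
  card-partition {R} {J} J⊆R N⊆R indep = begin
    countV (lookup R)
      ≡⟨ countV-+ (lookup R) J∪N (free R J) (λ x → 𝟙-partition (lookup R x) (lookup J x) _ J⊆R N⊆R) ⟩
    countV J∪N ℕ.+ countV (free R J)
      ≡⟨ cong (ℕ._+ countV (free R J)) (countV-+ J∪N (lookup J) (lookup (nbhd G J)) disjoint) ⟩
    (card J ℕ.+ card (nbhd G J)) ℕ.+ countV (free R J) ∎
    where
    open ≡-Reasoning
    J∪N : Fin n → Bool
    J∪N x = lookup J x ∨ lookup (nbhd G J) x
    disjoint : ∀ x → ℕΣ.𝟙 (J∪N x) ≡ ℕΣ.𝟙 (lookup J x) ℕ.+ ℕΣ.𝟙 (lookup (nbhd G J) x)
    disjoint x = 𝟙-∨-disjoint (lookup J x) _ (λ x∈J x∈N → nbhd-disjoint {J} indep x∈N x∈J)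

  module _ {J} (indep : Independent J) where

    private
      n≡ : n ≡ (card J ℕ.+ card (nbhd G J)) ℕ.+ countV (free ⊤ J)
      n≡ = trans (sym card-⊤) (card-partition {⊤} {J} (λ {v} _ → ∈⊤ v) (λ {v} _ → ∈⊤ v) indep)

    a≡free : a G J ≡ countV (free ⊤ J)
    a≡free = begin
      n ℕ.∸ card J ℕ.∸ card (nbhd G J)         ≡⟨ ℕ.∸-+-assoc n (card J) _ ⟩
      n ℕ.∸ (card J ℕ.+ card (nbhd G J))       ≡⟨ cong (ℕ._∸ (card J ℕ.+ card (nbhd G J))) n≡ ⟩
      (card J ℕ.+ card (nbhd G J)) ℕ.+ countV (free ⊤ J) ℕ.∸ (card J ℕ.+ card (nbhd G J))
                                               ≡⟨ ℕ.m+n∸m≡n (card J ℕ.+ card (nbhd G J)) _ ⟩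
      countV (free ⊤ J)                        ∎
      where open ≡-Reasoning

    n∸a : n ℕ.∸ a G J ≡ card J ℕ.+ card (nbhd G J)
    n∸a = trans (cong₂ ℕ._∸_ n≡ a≡free) (ℕ.m+n∸n≡m _ (countV (free ⊤ J)))

    b-rec : ∑ (allFin n) (λ v → if lookup J v then b G (J ∖ v) else 0ℚ) ≡
            ℕtoℚ (card J ℕ.+ card (nbhd G J)) * b G J
    b-rec = unfold (card J) refl
      where
      open ≡-Reasoning
      S : ℚ
      S = ∑ (allFin n) (λ v → if lookup J v then b G (J ∖ v) else 0ℚ)
      unfold : ∀ c → card J ≡ c → S ≡ ℕtoℚ (card J ℕ.+ card (nbhd G J)) * bAux G c J
      unfold zero |J| = begin
        S                                          ≡⟨ ∑-cong (allFin n) (λ v → vanish v (card≡0⁻ J |J| v)) ⟩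
        ∑ (allFin n) (λ _ → 0ℚ)                    ≡⟨ ∑-zero (allFin n) ⟩
        0ℚ * 1ℚ                                    ≡⟨ cong (λ m → ℕtoℚ m * 1ℚ) (cong₂ ℕ._+_ |J| |N|) ⟨
        ℕtoℚ (card J ℕ.+ card (nbhd G J)) * 1ℚ     ∎
        where
        vanish : ∀ v → v ∉ J → (if lookup J v then b G (J ∖ v) else 0ℚ) ≡ 0ℚ
        vanish v v∉J with lookup J v
        ... | false = refl
        ... | true  = ⊥-elim (v∉J _)
        |N| : card (nbhd G J) ≡ 0
        |N| = countV≡0⁺ (lookup (nbhd G J)) (λ x x∈N → let (v , v∈J , _) = ∈-nbhd⁻ {J} x∈N in card≡0⁻ J |J| v v∈J)
      unfold (suc c) |J| = begin
        S                                                          ≡⟨ ∑-cong (allFin n) step ⟩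
        S′                                                         ≡⟨ ℚ.*-identityˡ S′ ⟨
        1ℚ * S′                                                    ≡⟨ cong (_* S′) (ℕtoℚ*inv (c ℕ.+ card (nbhd G J))) ⟨
        (ℕtoℚ (suc c ℕ.+ card (nbhd G J)) * inv (suc c ℕ.+ card (nbhd G J))) * S′
          ≡⟨ cong (λ m → (ℕtoℚ m * inv m) * S′) (trans n∸a (cong (ℕ._+ card (nbhd G J)) |J|)) ⟨
        (ℕtoℚ (n ℕ.∸ a G J) * inv (n ℕ.∸ a G J)) * S′               ≡⟨ ℚ.*-assoc (ℕtoℚ (n ℕ.∸ a G J)) _ S′ ⟩
        ℕtoℚ (n ℕ.∸ a G J) * (inv (n ℕ.∸ a G J) * S′)
          ≡⟨ cong (λ m → ℕtoℚ m * (inv (n ℕ.∸ a G J) * S′)) n∸a ⟩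
        ℕtoℚ (card J ℕ.+ card (nbhd G J)) * (inv (n ℕ.∸ a G J) * S′) ∎
        where
        S′ : ℚ
        S′ = ∑ (allFin n) (λ v → if lookup J v then bAux G c (J ∖ v) else 0ℚ)
        step : ∀ v → (if lookup J v then b G (J ∖ v) else 0ℚ) ≡ (if lookup J v then bAux G c (J ∖ v) else 0ℚ)
        step v with lookup J v in v∈J
        ... | false = refl
        ... | true  = cong (λ k → bAux G k (J ∖ v)) (ℕ.suc-injective (trans (sym (card-∖ J (subst T (sym v∈J) _))) |J|))

-- Bad vertices and arrangements

module _ {n} (G : Graph n) where

  Bad : (Fin n → Fin n) → Fin n → Set
  Bad π v = toℕ (π v) ≢ 0 × (∀ {u} → T (adj G v u) → π v < π u)

  bad⁺ : ∀ π v → Bad π v → T (bad G π v)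
  bad⁺ π v (nonzero , first) =
    ∧⁺ (not⁺ (nonzero ∘ ℕ.≡ᵇ⇒≡ _ 0))
       (allV⁺ (λ u → not (adj G v u) ∨ (toℕ (π v) ℕ.<ᵇ toℕ (π u))) (λ u → impl⁺ (ℕ.<⇒<ᵇ ∘ first)))

  bad⁻ : ∀ π v → T (bad G π v) → Bad π v
  bad⁻ π v h with ∧⁻ {not (toℕ (π v) ℕ.≡ᵇ 0)} h
  ... | nonzero , first =
    (λ eq → not⁻ nonzero (ℕ.≡⇒≡ᵇ _ 0 eq)) ,
    (λ {u} vu → ℕ.<ᵇ⇒< _ _ (impl⁻ (allV⁻ (λ u → not (adj G v u) ∨ (toℕ (π v) ℕ.<ᵇ toℕ (π u))) first u) vu))

  bad-cong : ∀ {π π′} → π ≗ π′ → ∀ v → bad G π v ≡ bad G π′ v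
  bad-cong π≗π′ v = cong₂ _∧_ (cong (λ x → not (toℕ x ℕ.≡ᵇ 0)) (π≗π′ v))
    (allV-cong (λ u → cong₂ (λ x y → not (adj G v u) ∨ (toℕ x ℕ.<ᵇ toℕ y)) (π≗π′ v) (π≗π′ u)))

  bad-independent : ∀ {π I} → (∀ {v} → v ∈ I → Bad π v) → Independent G I
  bad-independent I⊆bad {u} {v} u∈I v∈I uv =
    ℕ.<-asym (proj₂ (I⊆bad u∈I) uv) (proj₂ (I⊆bad v∈I) (subst T (adj-sym G u v) uv))

module _ {n} (G : Graph n) (I : Subset n) where

  Good : ∀ {r} → (Fin r → Fin n) → Set
  Good σ = ∀ {i j} → σ i ∈ I → T (adj G (σ i) (σ j)) → i < j

  goodᵇ : ∀ {r} → (Fin r → Fin n) → Bool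
  goodᵇ σ = allV (λ i → not (lookup I (σ i)) ∨ allV (λ j → not (adj G (σ i) (σ j)) ∨ (toℕ i ℕ.<ᵇ toℕ j)))

  goodᵇ⁺ : ∀ {r} (σ : Fin r → Fin n) → Good σ → T (goodᵇ σ)
  goodᵇ⁺ σ good = allV⁺ _ (λ i → impl⁺ (λ σi∈I →
    allV⁺ (λ j → not (adj G (σ i) (σ j)) ∨ (toℕ i ℕ.<ᵇ toℕ j)) (λ j → impl⁺ (ℕ.<⇒<ᵇ ∘ good σi∈I))))

  goodᵇ⁻ : ∀ {r} (σ : Fin r → Fin n) → T (goodᵇ σ) → Good σ
  goodᵇ⁻ σ h {i} {j} σi∈I σiσj = ℕ.<ᵇ⇒< _ _ (impl⁻ (allV⁻ (λ j → not (adj G (σ i) (σ j)) ∨ (toℕ i ℕ.<ᵇ toℕ j))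
                                                       (impl⁻ (allV⁻ _ h i) σi∈I) j) σiσj)

  goodᵇ-cong : ∀ {r} {σ σ′ : Fin r → Fin n} → σ ≗ σ′ → goodᵇ σ ≡ goodᵇ σ′
  goodᵇ-cong σ≗σ′ = allV-cong (λ i → cong₂ _∨_ (cong (λ x → not (lookup I x)) (σ≗σ′ i))
    (allV-cong (λ j → cong₂ (λ x y → not (adj G x y) ∨ (toℕ i ℕ.<ᵇ toℕ j)) (σ≗σ′ i) (σ≗σ′ j))))

module _ {n} (G : Graph (suc n)) (I : Subset (suc n)) {π τ : Fin (suc n) → Fin (suc n)}
         (πτ : StrictlyInverseˡ _≡_ π τ) (τπ : StrictlyInverseʳ _≡_ π τ) where

  bad⇒good : (∀ {v} → v ∈ I → Bad G π v) → τ zero ∉ I × Good G I τ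
  bad⇒good I⊆bad = (λ τ₀∈I → proj₁ (I⊆bad τ₀∈I) (cong toℕ (πτ zero))) ,
                   (λ {i} {j} τi∈I τiτj → subst₂ _<_ (πτ i) (πτ j) (proj₂ (I⊆bad τi∈I) τiτj))

  good⇒bad : τ zero ∉ I → Good G I τ → ∀ {v} → v ∈ I → Bad G π v
  good⇒bad τ₀∉I good {v} v∈I = nonzero , first
    where
    nonzero : toℕ (π v) ≢ 0
    nonzero πv≡0 = τ₀∉I (subst (_∈ I) (trans (sym (τπ v)) (cong τ (Fin.toℕ-injective πv≡0))) v∈I)
    first : ∀ {u} → T (adj G v u) → π v < π u
    first {u} vu = good (subst (_∈ I) (sym (τπ v)) v∈I)
                        (subst₂ (λ x y → T (adj G x y)) (sym (τπ v)) (sym (τπ u)) vu)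

-- j, r, m tell whether the first vertex lies in J = I ∩ R, in R and in N(J): it is either in J
-- or one of the free vertices of R.
first-vertex-split : ∀ j r m F {B′ B} → (T j → T r) → (T j → ¬ T m) → (¬ T j → B′ ≡ B) →
  𝟙 (r ∧ not m) * (F * B′) ≡ F * (if j then B′ else 0ℚ) + 𝟙 (r ∧ not (j ∨ m)) * (F * B)
first-vertex-split true  true  false F {B′} {B} _ _ _ =
  trans (ℚ.*-identityˡ (F * B′)) (sym (trans (cong (F * B′ +_) (ℚ.*-zeroˡ (F * B))) (ℚ.+-identityʳ (F * B′))))
first-vertex-split true  false m     F j⇒r _    _ = ⊥-elim (j⇒r _)
first-vertex-split true  true  true  F _   disj _ = ⊥-elim (disj _ _)
first-vertex-split false r     m     F {B′} {B} _ _ B′≡B =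
  trans (cong (λ X → 𝟙 (r ∧ not m) * (F * X)) (B′≡B (λ ())))
        (sym (trans (cong (_+ 𝟙 (r ∧ not m) * (F * B)) (ℚ.*-zeroʳ F))
                    (ℚ.+-identityˡ (𝟙 (r ∧ not m) * (F * B)))))

module _ {n} (G : Graph n) (I : Subset n) where

  record Arrangement (R : Subset n) {r} (σ : Fin r → Fin n) : Set where
    field
      injective : Injective _≡_ _≡_ σ
      into      : ∀ i → σ i ∈ R
      onto      : ∀ {v} → v ∈ R → ∃ λ i → σ i ≡ v
      good      : Good G I σ

  arrangementᵇ : Subset n → ∀ {r} → (Fin r → Fin n) → Bool
  arrangementᵇ R σ = injectiveᵇ σ ∧ (intoᵇ R σ ∧ (ontoᵇ R σ ∧ goodᵇ G I σ))

  arrangementᵇ-cong : ∀ R {r} {σ σ′ : Fin r → Fin n} → σ ≗ σ′ → arrangementᵇ R σ ≡ arrangementᵇ R σ′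
  arrangementᵇ-cong R σ≗σ′ = cong₂ _∧_ (injectiveᵇ-cong σ≗σ′)
    (cong₂ _∧_ (intoᵇ-cong R σ≗σ′) (cong₂ _∧_ (ontoᵇ-cong R σ≗σ′) (goodᵇ-cong G I σ≗σ′)))

  arrangementᵇ⁺ : ∀ {R r} (σ : Fin r → Fin n) → Arrangement R σ → T (arrangementᵇ R σ)
  arrangementᵇ⁺ {R} σ arranged = ∧⁺ (injectiveᵇ⁺ σ injective)
    (∧⁺ (intoᵇ⁺ {R = R} σ into) (∧⁺ (ontoᵇ⁺ {R = R} σ onto) (goodᵇ⁺ G I σ good)))
    where open Arrangement arranged

  arrangementᵇ⁻ : ∀ {R r} (σ : Fin r → Fin n) → T (arrangementᵇ R σ) → Arrangement R σ
  arrangementᵇ⁻ {R} σ h with ∧⁻ {injectiveᵇ σ} h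
  ... | inj , h′ with ∧⁻ {intoᵇ R σ} h′
  ... | into , h″ with ∧⁻ {ontoᵇ R σ} h″
  ... | onto , good = record
    { injective = injectiveᵇ⁻ σ inj
    ; into      = intoᵇ⁻ {R = R} σ into
    ; onto      = ontoᵇ⁻ {R = R} σ onto
    ; good      = goodᵇ⁻ G I σ good
    }

  Admissible : Subset n → Fin n → Set
  Admissible R x = x ∈ R × x ∉ nbhd G (I ∩ R)

  admissibleᵇ : Subset n → Fin n → Bool
  admissibleᵇ R x = lookup R x ∧ not (lookup (nbhd G (I ∩ R)) x)

  admissibleᵇ⁺ : ∀ {R x} → Admissible R x → T (admissibleᵇ R x)
  admissibleᵇ⁺ (x∈R , x∉N) = ∧⁺ x∈R (not⁺ x∉N)

  admissibleᵇ⁻ : ∀ {R x} → T (admissibleᵇ R x) → Admissible R x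
  admissibleᵇ⁻ {R} {x} h = Product.map₂ not⁻ (∧⁻ {lookup R x} h)

  arrangement-cons⁻ : ∀ {R r x} {σ : Fin r → Fin n} →
                      Arrangement R (consF x σ) → Admissible R x × Arrangement (R ∖ x) σ
  arrangement-cons⁻ {R} {x = x} {σ} arranged = (into zero , x∉N) , record
    { injective = Fin.suc-injective ∘ injective
    ; into      = λ i → ∈-∖⁺ {R = R} (into (suc i)) (λ σi≡x → Fin.0≢1+n (sym (injective σi≡x)))
    ; onto      = onto′
    ; good      = λ σi∈I σiσj → ℕ.s<s⁻¹ (good σi∈I σiσj)
    }
    where
    open Arrangement arranged
    x∉N : x ∉ nbhd G (I ∩ R)
    x∉N x∈N with ∈-nbhd⁻ G {I ∩ R} x∈N
    ... | v , v∈I∩R , vx with onto (proj₂ (∈-∩⁻ {J = I} v∈I∩R))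
    ...   | zero  , refl = subst T (adj-irrefl G x) vx
    ...   | suc j , refl = ℕ.n≮0 (good (proj₁ (∈-∩⁻ {J = I} v∈I∩R)) vx)
    onto′ : ∀ {v} → v ∈ R ∖ x → ∃ λ i → σ i ≡ v
    onto′ v∈R∖x with ∈-∖⁻ {R = R} v∈R∖x
    ... | v∈R , v≢x with onto v∈R
    ...   | zero  , refl = ⊥-elim (v≢x refl)
    ...   | suc i , σi≡v = i , σi≡v

  arrangement-cons⁺ : ∀ {R r x} {σ : Fin r → Fin n} →
                      Admissible R x → Arrangement (R ∖ x) σ → Arrangement R (consF x σ)
  arrangement-cons⁺ {R} {x = x} {σ} (x∈R , x∉N) arranged = record
    { injective = injective′
    ; into      = into′
    ; onto      = onto′
    ; good      = good′
    }
    where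
    open Arrangement arranged
    σ∈R : ∀ i → σ i ∈ R
    σ∈R i = proj₁ (∈-∖⁻ {R = R} (into i))
    σ≢x : ∀ i → σ i ≢ x
    σ≢x i = proj₂ (∈-∖⁻ {R = R} (into i))
    injective′ : Injective _≡_ _≡_ (consF x σ)
    injective′ {zero}  {zero}  _  = refl
    injective′ {zero}  {suc j} eq = ⊥-elim (σ≢x j (sym eq))
    injective′ {suc i} {zero}  eq = ⊥-elim (σ≢x i eq)
    injective′ {suc i} {suc j} eq = cong suc (injective eq)
    into′ : ∀ i → consF x σ i ∈ R
    into′ zero    = x∈R
    into′ (suc i) = σ∈R i
    onto′ : ∀ {v} → v ∈ R → ∃ λ i → consF x σ i ≡ v
    onto′ {v} v∈R with v Fin.≟ x
    ... | yes refl = zero , refl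
    ... | no v≢x   = let (i , σi≡v) = onto (∈-∖⁺ {R = R} v∈R v≢x) in suc i , σi≡v
    good′ : Good G I (consF x σ)
    good′ {zero}  {zero}  _     xx    = ⊥-elim (subst T (adj-irrefl G x) xx)
    good′ {zero}  {suc j} _     _     = ℕ.z<s
    good′ {suc i} {zero}  σi∈I  σix   = ⊥-elim (x∉N (∈-nbhd⁺ G {I ∩ R} (∈-∩⁺ {J = I} σi∈I (σ∈R i)) σix))
    good′ {suc i} {suc j} σi∈I  σiσj  = ℕ.s<s (good σi∈I σiσj)

  arrangementᵇ-cons : ∀ R {r} x (σ : Fin r → Fin n) →
                      arrangementᵇ R (consF x σ) ≡ admissibleᵇ R x ∧ arrangementᵇ (R ∖ x) σ
  arrangementᵇ-cons R x σ = T⇔→≡ (mk⇔ forth back)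
    where
    forth : T (arrangementᵇ R (consF x σ)) → T (admissibleᵇ R x ∧ arrangementᵇ (R ∖ x) σ)
    forth h = let (adm , arranged) = arrangement-cons⁻ (arrangementᵇ⁻ {R} (consF x σ) h)
              in ∧⁺ (admissibleᵇ⁺ {R} adm) (arrangementᵇ⁺ σ arranged)
    back : T (admissibleᵇ R x ∧ arrangementᵇ (R ∖ x) σ) → T (arrangementᵇ R (consF x σ))
    back h = let (adm , arranged) = ∧⁻ {admissibleᵇ R x} h
             in arrangementᵇ⁺ (consF x σ) (arrangement-cons⁺ (admissibleᵇ⁻ {R} adm) (arrangementᵇ⁻ {R ∖ x} σ arranged))

  arrangements : ℕ → Subset n → ℚ
  arrangements r R = ∑ (allFuns r n) (λ σ → 𝟙 (arrangementᵇ R σ))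

  arrangements-zero : ∀ R → card R ≡ 0 → arrangements 0 R ≡ 1ℚ
  arrangements-zero R |R| =
    trans (cong (λ b → 𝟙 b + 0ℚ) (T⇔→≡ {y = true} (mk⇔ _ (λ _ → arrangementᵇ⁺ empty arranged)))) (ℚ.+-identityʳ 1ℚ)
    where
    empty : Fin 0 → Fin n
    empty ()
    arranged : Arrangement R empty
    arranged = record
      { injective = λ { {()} }
      ; into      = λ ()
      ; onto      = λ {v} v∈R → ⊥-elim (card≡0⁻ R |R| v v∈R)
      ; good      = λ { {()} }
      }

  arrangements-by-first : ∀ (c : Fin n → Bool) r R →
    ∑ (allFuns (suc r) n) (λ σ → 𝟙 (c (σ zero) ∧ arrangementᵇ R σ)) ≡
    ∑ (allFin n) (λ x → 𝟙 (c x ∧ admissibleᵇ R x) * arrangements r (R ∖ x))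
  arrangements-by-first c r R = begin
    ∑ (allFuns (suc r) n) (λ σ → 𝟙 (c (σ zero) ∧ arrangementᵇ R σ))
      ≡⟨ ∑-allFuns-suc r n (λ σ → 𝟙 (c (σ zero) ∧ arrangementᵇ R σ)) ⟩
    ∑ (allFuns r n) (λ σ → ∑ (allFin n) (λ x → 𝟙 (c x ∧ arrangementᵇ R (consF x σ))))
      ≡⟨ ∑-cong (allFuns r n) (λ σ → ∑-cong (allFin n) (λ x → split x σ)) ⟩
    ∑ (allFuns r n) (λ σ → ∑ (allFin n) (λ x → 𝟙 (c x ∧ admissibleᵇ R x) * 𝟙 (arrangementᵇ (R ∖ x) σ)))
      ≡⟨ ∑-comm (allFuns r n) (allFin n) _ ⟩
    ∑ (allFin n) (λ x → ∑ (allFuns r n) (λ σ → 𝟙 (c x ∧ admissibleᵇ R x) * 𝟙 (arrangementᵇ (R ∖ x) σ)))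
      ≡⟨ ∑-cong (allFin n) (λ x → ∑-*ˡ (allFuns r n) (𝟙 (c x ∧ admissibleᵇ R x)) _) ⟩
    ∑ (allFin n) (λ x → 𝟙 (c x ∧ admissibleᵇ R x) * arrangements r (R ∖ x)) ∎
    where
    open ≡-Reasoning
    split : ∀ x σ → 𝟙 (c x ∧ arrangementᵇ R (consF x σ)) ≡ 𝟙 (c x ∧ admissibleᵇ R x) * 𝟙 (arrangementᵇ (R ∖ x) σ)
    split x σ = begin
      𝟙 (c x ∧ arrangementᵇ R (consF x σ))                     ≡⟨ cong (λ b → 𝟙 (c x ∧ b)) (arrangementᵇ-cons R x σ) ⟩
      𝟙 (c x ∧ (admissibleᵇ R x ∧ arrangementᵇ (R ∖ x) σ))     ≡⟨ cong 𝟙 (Bool.∧-assoc (c x) _ _) ⟨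
      𝟙 ((c x ∧ admissibleᵇ R x) ∧ arrangementᵇ (R ∖ x) σ)     ≡⟨ 𝟙-∧ (c x ∧ admissibleᵇ R x) _ ⟩
      𝟙 (c x ∧ admissibleᵇ R x) * 𝟙 (arrangementᵇ (R ∖ x) σ)   ∎

  Closed : Subset n → Set
  Closed R = ∀ {v} → v ∈ nbhd G (I ∩ R) → v ∈ R

  closed-∖ : ∀ {R x} → Closed R → Admissible R x → Closed (R ∖ x)
  closed-∖ {R} {x} closed (_ , x∉N) {v} v∈N′ with ∈-nbhd⁻ G {I ∩ (R ∖ x)} v∈N′
  ... | u , u∈I∩R∖x , uv = ∈-∖⁺ {R = R} (closed v∈N) (λ v≡x → x∉N (subst (_∈ nbhd G (I ∩ R)) v≡x v∈N))
    where
    u∈I∩R : u ∈ I ∩ R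
    u∈I∩R = let (u∈I , u∈R∖x) = ∈-∩⁻ {J = I} u∈I∩R∖x in ∈-∩⁺ {J = I} u∈I (proj₁ (∈-∖⁻ {R = R} u∈R∖x))
    v∈N : v ∈ nbhd G (I ∩ R)
    v∈N = ∈-nbhd⁺ G {I ∩ R} u∈I∩R uv

  ∑-admissible : Independent G I → ∀ {R} → Closed R → ∀ r! →
    ∑ (allFin n) (λ x → 𝟙 (admissibleᵇ R x) * (r! * b G ((I ∩ R) ∖ x))) ≡ ℕtoℚ (card R) * (r! * b G (I ∩ R))
  ∑-admissible indep {R} closed r! = begin
    ∑ (allFin n) (λ x → 𝟙 (admissibleᵇ R x) * (r! * b G (J ∖ x)))
      ≡⟨ ∑-cong (allFin n) split ⟩
    ∑ (allFin n) (λ x → r! * (if lookup J x then b G (J ∖ x) else 0ℚ) + 𝟙 (free G R J x) * (r! * b G J))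
      ≡⟨ ∑-+ (allFin n) _ _ ⟩
    ∑ (allFin n) (λ x → r! * (if lookup J x then b G (J ∖ x) else 0ℚ)) +
    ∑ (allFin n) (λ x → 𝟙 (free G R J x) * (r! * b G J))
      ≡⟨ cong₂ _+_ (∑-*ˡ (allFin n) r! _) (∑-*ʳ (allFin n) (r! * b G J) (𝟙 ∘ free G R J)) ⟩
    r! * ∑ (allFin n) (λ x → if lookup J x then b G (J ∖ x) else 0ℚ) + ∑ (allFin n) (𝟙 ∘ free G R J) * (r! * b G J)
      ≡⟨ cong₂ _+_ (cong (r! *_) (b-rec G {J} indepJ))
                   (cong (_* (r! * b G J)) (sym (ℕtoℚ-length-filterᵇ (free G R J) (allFin n)))) ⟩
    r! * (ℕtoℚ s * b G J) + ℕtoℚ f * (r! * b G J)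
      ≡⟨ cong (_+ ℕtoℚ f * (r! * b G J)) (ℚ*.x∙yz≈y∙xz r! (ℕtoℚ s) (b G J)) ⟩
    ℕtoℚ s * (r! * b G J) + ℕtoℚ f * (r! * b G J)
      ≡⟨ ℚ.*-distribʳ-+ (r! * b G J) (ℕtoℚ s) (ℕtoℚ f) ⟨
    (ℕtoℚ s + ℕtoℚ f) * (r! * b G J)
      ≡⟨ cong (_* (r! * b G J)) (trans (cong ℕtoℚ |R|≡s+f) (ℕtoℚ-+ s f)) ⟨
    ℕtoℚ (card R) * (r! * b G J) ∎
    where
    open ≡-Reasoning
    J : Subset n
    J = I ∩ R
    s : ℕ
    s = card J ℕ.+ card (nbhd G J)
    f : ℕ
    f = countV (free G R J)
    indepJ : Independent G J
    indepJ u∈J v∈J = indep (proj₁ (∈-∩⁻ {J = I} u∈J)) (proj₁ (∈-∩⁻ {J = I} v∈J))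
    |R|≡s+f : card R ≡ s ℕ.+ f
    |R|≡s+f = card-partition G {R} {J} (proj₂ ∘ ∈-∩⁻ {J = I}) closed indepJ
    split : ∀ x → 𝟙 (admissibleᵇ R x) * (r! * b G (J ∖ x)) ≡
                  r! * (if lookup J x then b G (J ∖ x) else 0ℚ) + 𝟙 (free G R J x) * (r! * b G J)
    split x = first-vertex-split (lookup J x) (lookup R x) (lookup (nbhd G J) x) r!
      (proj₂ ∘ ∈-∩⁻ {J = I}) (λ x∈J x∈N → nbhd-disjoint G {J} indepJ x∈N x∈J)
      (λ x∉J → cong (b G) (∖-∉ J x∉J))

  module _ (indep : Independent G I) where

    count-arrangements : ∀ r R → card R ≡ r → Closed R → arrangements r R ≡ ℕtoℚ (r !) * b G (I ∩ R)
    count-arrangements zero R |R| _ = begin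
      arrangements 0 R          ≡⟨ arrangements-zero R |R| ⟩
      1ℚ                        ≡⟨ cong (λ c → bAux G c (I ∩ R)) |I∩R| ⟨
      b G (I ∩ R)               ≡⟨ ℚ.*-identityˡ _ ⟨
      1ℚ * b G (I ∩ R)          ∎
      where
      open ≡-Reasoning
      |I∩R| : card (I ∩ R) ≡ 0
      |I∩R| = countV≡0⁺ (lookup (I ∩ R)) (λ v v∈I∩R → card≡0⁻ R |R| v (proj₂ (∈-∩⁻ {J = I} v∈I∩R)))
    count-arrangements (suc r) R |R| closed = begin
      arrangements (suc r) R
        ≡⟨ arrangements-by-first (λ _ → true) r R ⟩
      ∑ (allFin n) (λ x → 𝟙 (admissibleᵇ R x) * arrangements r (R ∖ x))
        ≡⟨ ∑-cong (allFin n) (λ x → 𝟙-*-cong (admissibleᵇ R x) (induction x)) ⟩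
      ∑ (allFin n) (λ x → 𝟙 (admissibleᵇ R x) * (r! * b G ((I ∩ R) ∖ x)))
        ≡⟨ ∑-admissible indep closed r! ⟩
      ℕtoℚ (card R) * (r! * b G (I ∩ R))
        ≡⟨ cong (λ m → ℕtoℚ m * (r! * b G (I ∩ R))) |R| ⟩
      ℕtoℚ (suc r) * (r! * b G (I ∩ R))
        ≡⟨ trans (sym (ℚ.*-assoc (ℕtoℚ (suc r)) r! _)) (cong (_* b G (I ∩ R)) (sym (ℕtoℚ-* (suc r) (r !)))) ⟩
      ℕtoℚ (suc r !) * b G (I ∩ R) ∎
      where
      open ≡-Reasoning
      r! : ℚ
      r! = ℕtoℚ (r !)
      induction : ∀ x → T (admissibleᵇ R x) → arrangements r (R ∖ x) ≡ r! * b G ((I ∩ R) ∖ x)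
      induction x adm = trans (count-arrangements r (R ∖ x) |R∖x| (closed-∖ closed (x∈R , x∉N)))
                              (cong (λ K → r! * b G K) (∩-∖ I R x))
        where
        x∈R : x ∈ R
        x∈R = proj₁ (admissibleᵇ⁻ {R} adm)
        x∉N : x ∉ nbhd G (I ∩ R)
        x∉N = proj₂ (admissibleᵇ⁻ {R} adm)
        |R∖x| : card (R ∖ x) ≡ r
        |R∖x| = ℕ.suc-injective (trans (sym (card-∖ R x∈R)) |R|)

module _ {n} (G : Graph (suc n)) (I : Subset (suc n)) where

  badOnᵇ : (Fin (suc n) → Fin (suc n)) → Bool
  badOnᵇ π = isBijection π ∧ (I ⊆ᵇ bad G π)

  startsOutsideᵇ : (Fin (suc n) → Fin (suc n)) → Bool
  startsOutsideᵇ σ = not (lookup I (σ zero)) ∧ arrangementᵇ G I ⊤ σ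

  badOn⇒startsOutside : ∀ π → T (badOnᵇ π) → T (startsOutsideᵇ (inverse π))
  badOn⇒startsOutside π h = ∧⁺ (not⁺ (proj₁ τ-good)) (arrangementᵇ⁺ G I {⊤} (inverse π) record
    { injective = inverse-injective inj surj
    ; into      = ∈⊤ ∘ inverse π
    ; onto      = λ {v} _ → inverse-surjective inj surj v
    ; good      = proj₂ τ-good
    })
    where
    inj : Injective _≡_ _≡_ π
    inj = proj₁ (isBijection⁻ π (proj₁ (∧⁻ {isBijection π} h)))
    surj : StrictlySurjective _≡_ π
    surj = proj₂ (isBijection⁻ π (proj₁ (∧⁻ {isBijection π} h)))
    I⊆bad : ∀ {v} → v ∈ I → Bad G π v
    I⊆bad {v} v∈I = bad⁻ G π v (⊆ᵇ⁻ {I = I} (proj₂ (∧⁻ {isBijection π} h)) v∈I)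
    τ-good : inverse π zero ∉ I × Good G I (inverse π)
    τ-good = bad⇒good G I (inverse-section surj) (inverse-retraction inj surj) I⊆bad

  startsOutside⇒badOn : ∀ σ → T (startsOutsideᵇ σ) → T (badOnᵇ (inverse σ))
  startsOutside⇒badOn σ h = ∧⁺ (isBijection⁺ (inverse σ) (inverse-injective inj surj) (inverse-surjective inj surj))
    (⊆ᵇ⁺ {I = I} (λ {v} v∈I → bad⁺ G (inverse σ) v (I⊆bad v∈I)))
    where
    σ₀∉I : σ zero ∉ I
    σ₀∉I = not⁻ (proj₁ (∧⁻ {not (lookup I (σ zero))} h))
    arranged : Arrangement G I ⊤ σ
    arranged = arrangementᵇ⁻ G I {⊤} σ (proj₂ (∧⁻ {not (lookup I (σ zero))} h))
    inj : Injective _≡_ _≡_ σ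
    inj = Arrangement.injective arranged
    surj : StrictlySurjective _≡_ σ
    surj y = Arrangement.onto arranged (∈⊤ y)
    I⊆bad : ∀ {v} → v ∈ I → Bad G (inverse σ) v
    I⊆bad = good⇒bad G I (inverse-retraction inj surj) (inverse-section surj) σ₀∉I (Arrangement.good arranged)

  inversion : Correspondence badOnᵇ startsOutsideᵇ
  inversion = record
    { to        = inverse
    ; from      = inverse
    ; to-cong   = inverse-cong
    ; from-cong = inverse-cong
    ; P-cong    = λ π≗π′ → cong₂ _∧_ (isBijection-cong π≗π′)
                                     (allV-cong (λ v → cong (not (lookup I v) ∨_) (bad-cong G π≗π′ v)))
    ; Q-cong    = λ σ≗σ′ → cong₂ _∧_ (cong (λ x → not (lookup I x)) (σ≗σ′ zero)) (arrangementᵇ-cong G I ⊤ σ≗σ′)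
    ; to-Q      = λ {π} → badOn⇒startsOutside π
    ; from-P    = λ {σ} → startsOutside⇒badOn σ
    ; from∘to   = λ {π} h → let (inj , surj) = isBijection⁻ π (proj₁ (∧⁻ {isBijection π} h))
                             in inverse-involutive inj surj
    ; to∘from   = λ {σ} h → let arranged = arrangementᵇ⁻ G I {⊤} σ (proj₂ (∧⁻ {not (lookup I (σ zero))} h))
                             in inverse-involutive (Arrangement.injective arranged) (Arrangement.onto arranged ∘ ∈⊤)
    }

  outsideᵇ : Fin (suc n) → Bool
  outsideᵇ x = not (lookup I x) ∧ admissibleᵇ G I ⊤ x

  outsideᵇ≡free : ∀ x → outsideᵇ x ≡ free G ⊤ I x
  outsideᵇ≡free x = trans (cong (λ J → not (lookup I x) ∧ (lookup ⊤ x ∧ not (lookup (nbhd G J) x))) (∩-⊤ I))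
                          (reorder (lookup I x) (lookup ⊤ x) (lookup (nbhd G I) x))
    where
    reorder : ∀ i t m → not i ∧ (t ∧ not m) ≡ t ∧ not (i ∨ m)
    reorder true  t m = sym (Bool.∧-zeroʳ t)
    reorder false t m = refl

  factorial*w : ℕtoℚ (suc n !) * w G I ≡ ℕtoℚ (a G I) * (ℕtoℚ (n !) * b G I)
  factorial*w = begin
    ℕtoℚ (suc n !) * ((ℕtoℚ (a G I) * inv (suc n)) * b G I)
      ≡⟨ cong (_* ((ℕtoℚ (a G I) * inv (suc n)) * b G I)) (ℕtoℚ-* (suc n) (n !)) ⟩
    (ℕtoℚ (suc n) * ℕtoℚ (n !)) * ((ℕtoℚ (a G I) * inv (suc n)) * b G I)
      ≡⟨ solve 5 (λ S F A iS B → (S :* F) :* ((A :* iS) :* B) := (S :* iS) :* (A :* (F :* B))) refl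
              (ℕtoℚ (suc n)) (ℕtoℚ (n !)) (ℕtoℚ (a G I)) (inv (suc n)) (b G I) ⟩
    (ℕtoℚ (suc n) * inv (suc n)) * (ℕtoℚ (a G I) * (ℕtoℚ (n !) * b G I))
      ≡⟨ trans (cong (_* (ℕtoℚ (a G I) * (ℕtoℚ (n !) * b G I))) (ℕtoℚ*inv n)) (ℚ.*-identityˡ _) ⟩
    ℕtoℚ (a G I) * (ℕtoℚ (n !) * b G I) ∎
    where
    open ≡-Reasoning
    open +-*-Solver using (solve; _:*_; _:=_)

  module _ (indep : Independent G I) where

    arrangements-after : ∀ x → T (outsideᵇ x) → arrangements G I n (⊤ ∖ x) ≡ ℕtoℚ (n !) * b G I
    arrangements-after x h = trans (count-arrangements G I indep n (⊤ ∖ x) |⊤∖x| closed)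
      (cong (λ K → ℕtoℚ (n !) * b G K) (trans (∩-∖ I ⊤ x) (trans (cong (_∖ x) (∩-⊤ I)) (∖-∉ I x∉I))))
      where
      x∉I : x ∉ I
      x∉I = not⁻ (proj₁ (∧⁻ {not (lookup I x)} h))
      |⊤∖x| : card (⊤ ∖ x) ≡ n
      |⊤∖x| = ℕ.suc-injective (trans (sym (card-∖ ⊤ {x} (∈⊤ x))) card-⊤)
      closed : Closed G I (⊤ ∖ x)
      closed = closed-∖ G I {⊤} {x} (λ {v} _ → ∈⊤ v) (admissibleᵇ⁻ G I {⊤} {x} (proj₂ (∧⁻ {not (lookup I x)} h)))

    count-badOn : ∑ (allFuns (suc n) (suc n)) (𝟙 ∘ badOnᵇ) ≡ ℕtoℚ (suc n !) * w G I
    count-badOn = begin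
      ∑ (allFuns (suc n) (suc n)) (𝟙 ∘ badOnᵇ)
        ≡⟨ count-correspondence inversion ⟩
      ∑ (allFuns (suc n) (suc n)) (𝟙 ∘ startsOutsideᵇ)
        ≡⟨ arrangements-by-first G I (λ x → not (lookup I x)) n ⊤ ⟩
      ∑ (allFin (suc n)) (λ x → 𝟙 (outsideᵇ x) * arrangements G I n (⊤ ∖ x))
        ≡⟨ ∑-cong (allFin (suc n)) (λ x → 𝟙-*-cong (outsideᵇ x) (arrangements-after x)) ⟩
      ∑ (allFin (suc n)) (λ x → 𝟙 (outsideᵇ x) * (ℕtoℚ (n !) * b G I))
        ≡⟨ ∑-*ʳ (allFin (suc n)) (ℕtoℚ (n !) * b G I) (𝟙 ∘ outsideᵇ) ⟩
      ∑ (allFin (suc n)) (𝟙 ∘ outsideᵇ) * (ℕtoℚ (n !) * b G I)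
        ≡⟨ cong (_* (ℕtoℚ (n !) * b G I)) (∑-cong (allFin (suc n)) (cong 𝟙 ∘ outsideᵇ≡free)) ⟩
      ∑ (allFin (suc n)) (𝟙 ∘ free G ⊤ I) * (ℕtoℚ (n !) * b G I)
        ≡⟨ cong (_* (ℕtoℚ (n !) * b G I)) (trans (cong ℕtoℚ (a≡free G {I} indep))
                                                 (ℕtoℚ-length-filterᵇ (free G ⊤ I) (allFin (suc n)))) ⟨
      ℕtoℚ (a G I) * (ℕtoℚ (n !) * b G I)
        ≡⟨ factorial*w ⟨
      ℕtoℚ (suc n !) * w G I ∎
      where open ≡-Reasoning

-- Binomial sums and Taylor coefficients at -1

∑-allSubsets-suc : ∀ n (f : Subset (suc n) → ℕ) →
  ℕΣ.∑ (allSubsets (suc n)) f ≡ ℕΣ.∑ (allSubsets n) (f ∘ (false ∷_)) ℕ.+ ℕΣ.∑ (allSubsets n) (f ∘ (true ∷_))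
∑-allSubsets-suc n f = trans (ℕΣ.∑-++ (map (false ∷_) (allSubsets n)) _ f)
  (cong₂ ℕ._+_ (ℕΣ.∑-map (false ∷_) (allSubsets n) f) (ℕΣ.∑-map (true ∷_) (allSubsets n) f))

pascal-𝟙 : ∀ s c j → c C suc j ℕ.+ ℕΣ.𝟙 s ℕ.* (c C j) ≡ (ℕΣ.𝟙 s ℕ.+ c) C suc j
pascal-𝟙 true  c j = trans (cong (c C suc j ℕ.+_) (ℕ.*-identityˡ (c C j)))
  (trans (ℕ.+-comm (c C suc j) (c C j)) (nCk+nC[k+1]≡[n+1]C[k+1] c j))
pascal-𝟙 false c j = ℕ.+-identityʳ (c C suc j)

subsets-of-size : ∀ n (S : Fin n → Bool) j →
  ℕΣ.∑ (allSubsets n) (λ I → ℕΣ.𝟙 ((card I ℕ.≡ᵇ j) ∧ (I ⊆ᵇ S))) ≡ countV S C j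
subsets-of-size zero    S zero    = refl
subsets-of-size zero    S (suc j) = refl
subsets-of-size (suc n) S j = begin
  ℕΣ.∑ (allSubsets (suc n)) (size-j S j)
    ≡⟨ ∑-allSubsets-suc n (size-j S j) ⟩
  ℕΣ.∑ (allSubsets n) (size-j S j ∘ (false ∷_)) ℕ.+ ℕΣ.∑ (allSubsets n) (size-j S j ∘ (true ∷_))
    ≡⟨ cong₂ ℕ._+_ (trans (ℕΣ.∑-cong (allSubsets n) without-0) (subsets-of-size n S′ j)) (with-0 j) ⟩
  countV S′ C j ℕ.+ containing-0 j
    ≡⟨ combine j ⟩
  countV S C j ∎
  where
  open ≡-Reasoning
  size-j : ∀ {m} → (Fin m → Bool) → ℕ → Subset m → ℕ
  size-j S j I = ℕΣ.𝟙 ((card I ℕ.≡ᵇ j) ∧ (I ⊆ᵇ S))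
  S′ : Fin n → Bool
  S′ = S ∘ suc
  ∷-size-j : ∀ j b I → size-j S j (b ∷ I) ≡ ℕΣ.𝟙 ((ℕΣ.𝟙 b ℕ.+ card I ℕ.≡ᵇ j) ∧ ((not b ∨ S zero) ∧ (I ⊆ᵇ S′)))
  ∷-size-j j b I = cong₂ (λ c s → ℕΣ.𝟙 ((c ℕ.≡ᵇ j) ∧ s)) (card-∷ b I) (allV-suc (λ v → not (lookup (b ∷ I) v) ∨ S v))
  without-0 : ∀ I → size-j S j (false ∷ I) ≡ size-j S′ j I
  without-0 = ∷-size-j j false
  containing-0 : ℕ → ℕ
  containing-0 zero    = 0
  containing-0 (suc j) = ℕΣ.𝟙 (S zero) ℕ.* (countV S′ C j)
  with-0 : ∀ j → ℕΣ.∑ (allSubsets n) (size-j S j ∘ (true ∷_)) ≡ containing-0 j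
  with-0 zero    = trans (ℕΣ.∑-cong (allSubsets n) (∷-size-j 0 true)) (ℕΣ.∑-zero (allSubsets n))
  with-0 (suc j) = begin
    ℕΣ.∑ (allSubsets n) (size-j S (suc j) ∘ (true ∷_))
      ≡⟨ ℕΣ.∑-cong (allSubsets n) (λ I → trans (∷-size-j (suc j) true I)
                                                (pull-out (card I ℕ.≡ᵇ j) (S zero) (I ⊆ᵇ S′))) ⟩
    ℕΣ.∑ (allSubsets n) (λ I → ℕΣ.𝟙 (S zero) ℕ.* size-j S′ j I)
      ≡⟨ ℕΣ.∑-*ˡ (allSubsets n) (ℕΣ.𝟙 (S zero)) (size-j S′ j) ⟩
    ℕΣ.𝟙 (S zero) ℕ.* ℕΣ.∑ (allSubsets n) (size-j S′ j)
      ≡⟨ cong (ℕΣ.𝟙 (S zero) ℕ.*_) (subsets-of-size n S′ j) ⟩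
    ℕΣ.𝟙 (S zero) ℕ.* (countV S′ C j) ∎
    where
    pull-out : ∀ a s b → ℕΣ.𝟙 (a ∧ (s ∧ b)) ≡ ℕΣ.𝟙 s ℕ.* ℕΣ.𝟙 (a ∧ b)
    pull-out a true  b = sym (ℕ.*-identityˡ _)
    pull-out a false b = cong ℕΣ.𝟙 (Bool.∧-zeroʳ a)
  combine : ∀ j → countV S′ C j ℕ.+ containing-0 j ≡ countV S C j
  combine zero    = refl
  combine (suc j) = trans (pascal-𝟙 (S zero) (countV S′) j) (cong (_C suc j) (sym (countV-suc S)))

absorption : ∀ n k → suc k ℕ.* (suc n C suc k) ≡ suc n ℕ.* (n C k)
absorption zero    zero    = refl
absorption zero    (suc k) = ℕ.*-zeroʳ (suc (suc k))
absorption (suc n) zero    = trans (ℕ.*-identityˡ _) (trans (nC1≡n (suc (suc n))) (sym (ℕ.*-identityʳ (suc (suc n)))))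
absorption (suc n) (suc k) = begin
  suc (suc k) ℕ.* (suc (suc n) C suc (suc k))
    ≡⟨ cong (suc (suc k) ℕ.*_) (nCk+nC[k+1]≡[n+1]C[k+1] (suc n) (suc k)) ⟨
  suc (suc k) ℕ.* (suc n C suc k ℕ.+ suc n C suc (suc k))
    ≡⟨ solve 3 (λ k x y → (con 2 :+ k) :* (x :+ y) := ((con 1 :+ k) :* x) :+ x :+ (con 2 :+ k) :* y) refl
         k (suc n C suc k) (suc n C suc (suc k)) ⟩
  suc k ℕ.* (suc n C suc k) ℕ.+ suc n C suc k ℕ.+ suc (suc k) ℕ.* (suc n C suc (suc k))
    ≡⟨ cong₂ (λ x y → x ℕ.+ suc n C suc k ℕ.+ y) (absorption n k) (absorption n (suc k)) ⟩
  suc n ℕ.* (n C k) ℕ.+ suc n C suc k ℕ.+ suc n ℕ.* (n C suc k)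
    ≡⟨ solve 4 (λ n x y z → (con 1 :+ n) :* x :+ y :+ (con 1 :+ n) :* z := y :+ (con 1 :+ n) :* (x :+ z)) refl
         n (n C k) (suc n C suc k) (n C suc k) ⟩
  suc n C suc k ℕ.+ suc n ℕ.* (n C k ℕ.+ n C suc k)
    ≡⟨ cong (λ x → suc n C suc k ℕ.+ suc n ℕ.* x) (nCk+nC[k+1]≡[n+1]C[k+1] n k) ⟩
  suc n C suc k ℕ.+ suc n ℕ.* (suc n C suc k) ∎
  where
  open ≡-Reasoning
  open ℕ-Solver using (solve; _:+_; _:*_; _:=_; con)

sign : ℕ → ℚ
sign zero    = 1ℚ
sign (suc i) = - sign i

∑-sign-suc : ∀ (f : ℕ → ℚ) m →
  ∑ (upTo (suc m)) (λ i → sign i * f i) ≡ f 0 + (- 1ℚ) * ∑ (upTo m) (λ i → sign i * f (suc i))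
∑-sign-suc f m = begin
  ∑ (upTo (suc m)) (λ i → sign i * f i)
    ≡⟨ ∑-upTo-suc m (λ i → sign i * f i) ⟩
  1ℚ * f 0 + ∑ (upTo m) (λ i → (- sign i) * f (suc i))
    ≡⟨ cong₂ _+_ (ℚ.*-identityˡ (f 0)) (∑-cong (upTo m) (λ i → flip (sign i) (f (suc i)))) ⟩
  f 0 + ∑ (upTo m) (λ i → (- 1ℚ) * (sign i * f (suc i)))
    ≡⟨ cong (f 0 +_) (∑-*ˡ (upTo m) (- 1ℚ) (λ i → sign i * f (suc i))) ⟩
  f 0 + (- 1ℚ) * ∑ (upTo m) (λ i → sign i * f (suc i)) ∎
  where
  open ≡-Reasoning
  open +-*-Solver using (solve; _:*_; _:=_; :-_; con)
  flip : ∀ s x → (- s) * x ≡ (- 1ℚ) * (s * x)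
  flip = solve 2 (λ s x → (:- s) :* x := con (- 1ℚ) :* (s :* x)) refl

alternating-binomial : ∀ n m → n ℕ.< m → ∑ (upTo m) (λ i → sign i * ℕtoℚ (n C i)) ≡ ℕtoℚ (ℕΣ.𝟙 (n ℕ.≡ᵇ 0))
alternating-binomial zero (suc m) _ = begin
  ∑ (upTo (suc m)) (λ i → sign i * ℕtoℚ (0 C i))  ≡⟨ ∑-sign-suc (λ i → ℕtoℚ (0 C i)) m ⟩
  1ℚ + (- 1ℚ) * ∑ (upTo m) (λ i → sign i * 0ℚ)    ≡⟨ cong (λ x → 1ℚ + (- 1ℚ) * x) vanish ⟩
  1ℚ + (- 1ℚ) * 0ℚ                                ≡⟨⟩
  1ℚ                                              ∎
  where
  open ≡-Reasoning
  vanish : ∑ (upTo m) (λ i → sign i * 0ℚ) ≡ 0ℚ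
  vanish = trans (∑-cong (upTo m) (ℚ.*-zeroʳ ∘ sign)) (∑-zero (upTo m))
alternating-binomial (suc n) (suc m) (ℕ.s≤s n<m) = begin
  U (suc n) (suc m)
    ≡⟨ ∑-sign-suc (λ i → ℕtoℚ (suc n C i)) m ⟩
  1ℚ + (- 1ℚ) * ∑ (upTo m) (λ i → sign i * ℕtoℚ (suc n C suc i))
    ≡⟨ cong (λ x → 1ℚ + (- 1ℚ) * x) (trans (∑-cong (upTo m) pascal) (∑-+ (upTo m) _ _)) ⟩
  1ℚ + (- 1ℚ) * (U n m + V)
    ≡⟨ solve 2 (λ u v → con 1ℚ :+ con (- 1ℚ) :* (u :+ v) := (con 1ℚ :+ con (- 1ℚ) :* v) :+ con (- 1ℚ) :* u)
               refl (U n m) V ⟩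
  (1ℚ + (- 1ℚ) * V) + (- 1ℚ) * U n m
    ≡⟨ cong (_+ (- 1ℚ) * U n m) (∑-sign-suc (λ i → ℕtoℚ (n C i)) m) ⟨
  U n (suc m) + (- 1ℚ) * U n m
    ≡⟨ cong₂ (λ x y → x + (- 1ℚ) * y) (alternating-binomial n (suc m) (ℕ.m<n⇒m<1+n n<m))
                                      (alternating-binomial n m n<m) ⟩
  [n≡0] + (- 1ℚ) * [n≡0]
    ≡⟨ solve 1 (λ x → x :+ con (- 1ℚ) :* x := con 0ℚ) refl [n≡0] ⟩
  0ℚ ∎
  where
  open ≡-Reasoning
  open +-*-Solver using (solve; _:+_; _:*_; _:=_; con)
  U : ℕ → ℕ → ℚ
  U n m = ∑ (upTo m) (λ i → sign i * ℕtoℚ (n C i))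
  V : ℚ
  V = ∑ (upTo m) (λ i → sign i * ℕtoℚ (n C suc i))
  [n≡0] : ℚ
  [n≡0] = ℕtoℚ (ℕΣ.𝟙 (n ℕ.≡ᵇ 0))
  pascal : ∀ i → sign i * ℕtoℚ (suc n C suc i) ≡ sign i * ℕtoℚ (n C i) + sign i * ℕtoℚ (n C suc i)
  pascal i = trans (cong (λ x → sign i * ℕtoℚ x) (sym (nCk+nC[k+1]≡[n+1]C[k+1] n i)))
                   (trans (cong (sign i *_) (ℕtoℚ-+ (n C i) (n C suc i))) (ℚ.*-distribˡ-+ (sign i) _ _))

-- risingFactorial (suc i) k is the coefficient of y^i in the k-th derivative of y^(i+k).
risingFactorial : ℕ → ℕ → ℕ
risingFactorial x zero    = 1
risingFactorial x (suc k) = (x ℕ.+ k) ℕ.* risingFactorial x k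

risingFactorial-suc : ∀ x k → x ℕ.* risingFactorial (suc x) k ≡ risingFactorial x (suc k)
risingFactorial-suc x zero    = cong (ℕ._* 1) (sym (ℕ.+-identityʳ x))
risingFactorial-suc x (suc k) = begin
  x ℕ.* ((suc x ℕ.+ k) ℕ.* risingFactorial (suc x) k)   ≡⟨ ℕ*.x∙yz≈y∙xz x (suc x ℕ.+ k) _ ⟩
  (suc x ℕ.+ k) ℕ.* (x ℕ.* risingFactorial (suc x) k)   ≡⟨ cong₂ ℕ._*_ (sym (ℕ.+-suc x k)) (risingFactorial-suc x k) ⟩
  (x ℕ.+ suc k) ℕ.* risingFactorial x (suc k)           ∎
  where open ≡-Reasoning

risingFactorial-absorption : ∀ n i k →
  risingFactorial (suc i) (suc k) ℕ.* (suc n C (i ℕ.+ suc k)) ≡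
  suc n ℕ.* (risingFactorial (suc i) k ℕ.* (n C (i ℕ.+ k)))
risingFactorial-absorption n i k = begin
  suc (i ℕ.+ k) ℕ.* risingFactorial (suc i) k ℕ.* (suc n C (i ℕ.+ suc k))
    ≡⟨ cong (λ j → suc (i ℕ.+ k) ℕ.* risingFactorial (suc i) k ℕ.* (suc n C j)) (ℕ.+-suc i k) ⟩
  suc (i ℕ.+ k) ℕ.* risingFactorial (suc i) k ℕ.* (suc n C suc (i ℕ.+ k))
    ≡⟨ ℕ*.xy∙z≈y∙xz (suc (i ℕ.+ k)) (risingFactorial (suc i) k) _ ⟩
  risingFactorial (suc i) k ℕ.* (suc (i ℕ.+ k) ℕ.* (suc n C suc (i ℕ.+ k)))
    ≡⟨ cong (risingFactorial (suc i) k ℕ.*_) (absorption n (i ℕ.+ k)) ⟩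
  risingFactorial (suc i) k ℕ.* (suc n ℕ.* (n C (i ℕ.+ k)))
    ≡⟨ ℕ*.x∙yz≈y∙xz (risingFactorial (suc i) k) (suc n) _ ⟩
  suc n ℕ.* (risingFactorial (suc i) k ℕ.* (n C (i ℕ.+ k))) ∎
  where open ≡-Reasoning

alternating-rising : ∀ k n t → n ℕ.< k ℕ.+ t →
  ∑ (upTo t) (λ i → sign i * ℕtoℚ (risingFactorial (suc i) k ℕ.* (n C (i ℕ.+ k)))) ≡
  ℕtoℚ (k ! ℕ.* ℕΣ.𝟙 (n ℕ.≡ᵇ k))
alternating-rising zero n t n<t = begin
  ∑ (upTo t) (λ i → sign i * ℕtoℚ (1 ℕ.* (n C (i ℕ.+ 0))))
    ≡⟨ ∑-cong (upTo t) (λ i → cong (λ x → sign i * ℕtoℚ x)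
                                   (trans (ℕ.*-identityˡ (n C (i ℕ.+ 0))) (cong (n C_) (ℕ.+-identityʳ i)))) ⟩
  ∑ (upTo t) (λ i → sign i * ℕtoℚ (n C i))
    ≡⟨ alternating-binomial n t n<t ⟩
  ℕtoℚ (ℕΣ.𝟙 (n ℕ.≡ᵇ 0))
    ≡⟨ cong ℕtoℚ (ℕ.*-identityˡ (ℕΣ.𝟙 (n ℕ.≡ᵇ 0))) ⟨
  ℕtoℚ (1 ℕ.* ℕΣ.𝟙 (n ℕ.≡ᵇ 0)) ∎
  where open ≡-Reasoning
alternating-rising (suc k) zero t _ = begin
  ∑ (upTo t) (λ i → sign i * ℕtoℚ (risingFactorial (suc i) (suc k) ℕ.* (0 C (i ℕ.+ suc k))))
    ≡⟨ ∑-cong (upTo t) vanish ⟩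
  ∑ (upTo t) (λ _ → 0ℚ)
    ≡⟨ ∑-zero (upTo t) ⟩
  0ℚ
    ≡⟨ cong ℕtoℚ (ℕ.*-zeroʳ (suc k !)) ⟨
  ℕtoℚ (suc k ! ℕ.* 0) ∎
  where
  open ≡-Reasoning
  vanish : ∀ i → sign i * ℕtoℚ (risingFactorial (suc i) (suc k) ℕ.* (0 C (i ℕ.+ suc k))) ≡ 0ℚ
  vanish i = trans (cong (λ j → sign i * ℕtoℚ (risingFactorial (suc i) (suc k) ℕ.* (0 C j))) (ℕ.+-suc i k))
    (trans (cong (λ x → sign i * ℕtoℚ x) (ℕ.*-zeroʳ (risingFactorial (suc i) (suc k)))) (ℚ.*-zeroʳ (sign i)))
alternating-rising (suc k) (suc n) t n<k+t = begin
  ∑ (upTo t) (λ i → sign i * ℕtoℚ (risingFactorial (suc i) (suc k) ℕ.* (suc n C (i ℕ.+ suc k))))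
    ≡⟨ ∑-cong (upTo t) (λ i → cong (λ x → sign i * ℕtoℚ x) (risingFactorial-absorption n i k)) ⟩
  ∑ (upTo t) (λ i → sign i * ℕtoℚ (suc n ℕ.* term i))
    ≡⟨ ∑-cong (upTo t) (λ i → trans (cong (sign i *_) (ℕtoℚ-* (suc n) (term i)))
                                    (ℚ*.x∙yz≈y∙xz (sign i) (ℕtoℚ (suc n)) (ℕtoℚ (term i)))) ⟩
  ∑ (upTo t) (λ i → ℕtoℚ (suc n) * (sign i * ℕtoℚ (term i)))
    ≡⟨ ∑-*ˡ (upTo t) (ℕtoℚ (suc n)) _ ⟩
  ℕtoℚ (suc n) * ∑ (upTo t) (λ i → sign i * ℕtoℚ (term i))
    ≡⟨ cong (ℕtoℚ (suc n) *_) (alternating-rising k n t (ℕ.s<s⁻¹ n<k+t)) ⟩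
  ℕtoℚ (suc n) * ℕtoℚ (k ! ℕ.* ℕΣ.𝟙 (n ℕ.≡ᵇ k))
    ≡⟨ ℕtoℚ-* (suc n) (k ! ℕ.* ℕΣ.𝟙 (n ℕ.≡ᵇ k)) ⟨
  ℕtoℚ (suc n ℕ.* (k ! ℕ.* ℕΣ.𝟙 (n ℕ.≡ᵇ k)))
    ≡⟨ cong ℕtoℚ (factorial (n ℕ.≡ᵇ k) (ℕ.≡ᵇ⇒≡ n k)) ⟩
  ℕtoℚ (suc k ! ℕ.* ℕΣ.𝟙 (n ℕ.≡ᵇ k)) ∎
  where
  open ≡-Reasoning
  term : ℕ → ℕ
  term i = risingFactorial (suc i) k ℕ.* (n C (i ℕ.+ k))
  factorial : ∀ e → (T e → n ≡ k) → suc n ℕ.* (k ! ℕ.* ℕΣ.𝟙 e) ≡ suc k ! ℕ.* ℕΣ.𝟙 e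
  factorial true  n≡k = trans (cong (λ x → suc x ℕ.* (k ! ℕ.* 1)) (n≡k _)) (sym (ℕ.*-assoc (suc k) (k !) 1))
  factorial false _   =
    trans (cong (suc n ℕ.*_) (ℕ.*-zeroʳ (k !))) (trans (ℕ.*-zeroʳ (suc n)) (sym (ℕ.*-zeroʳ (suc k !))))

applyUpTo-cong : ∀ {A : Set} {f g : ℕ → A} → f ≗ g → ∀ m → applyUpTo f m ≡ applyUpTo g m
applyUpTo-cong {f = f} {g} f≗g m =
  trans (sym (List.map-upTo f m)) (trans (List.map-cong f≗g (upTo m)) (List.map-upTo g m))

zipWith-applyUpTo : ∀ {A B C : Set} (h : A → B → C) u v t →
                    zipWith h (applyUpTo u t) (applyUpTo v t) ≡ applyUpTo (λ i → h (u i) (v i)) t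
zipWith-applyUpTo h u v zero    = refl
zipWith-applyUpTo h u v (suc t) = cong (h (u 0) (v 0) ∷_) (zipWith-applyUpTo h (u ∘ suc) (v ∘ suc) t)

deriv-applyUpTo : ∀ (g : ℕ → ℚ) t → deriv (applyUpTo g t) ≡ applyUpTo (λ i → ℕtoℚ (suc i) * g (suc i)) (ℕ.pred t)
deriv-applyUpTo g zero    = refl
deriv-applyUpTo g (suc t) =
  trans (cong (λ m → zipWith scale (upTo m) (applyUpTo (g ∘ suc) t)) (List.length-applyUpTo (g ∘ suc) t))
        (zipWith-applyUpTo scale (λ i → i) (g ∘ suc) t)
  where
  scale : ℕ → ℚ → ℚ
  scale i c = ℕtoℚ (suc i) * c

derivN-applyUpTo : ∀ (h : ℕ → ℚ) m k →
  derivN k (applyUpTo h m) ≡ applyUpTo (λ i → ℕtoℚ (risingFactorial (suc i) k) * h (i ℕ.+ k)) (m ℕ.∸ k)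
derivN-applyUpTo h m zero    = applyUpTo-cong (λ i → sym (trans (ℚ.*-identityˡ _) (cong h (ℕ.+-identityʳ i)))) m
derivN-applyUpTo h m (suc k) = begin
  deriv (derivN k (applyUpTo h m))
    ≡⟨ cong deriv (derivN-applyUpTo h m k) ⟩
  deriv (applyUpTo (λ i → ℕtoℚ (risingFactorial (suc i) k) * h (i ℕ.+ k)) (m ℕ.∸ k))
    ≡⟨ deriv-applyUpTo _ (m ℕ.∸ k) ⟩
  applyUpTo (λ i → ℕtoℚ (suc i) * (ℕtoℚ (risingFactorial (suc (suc i)) k) * h (suc i ℕ.+ k))) (ℕ.pred (m ℕ.∸ k))
    ≡⟨ applyUpTo-cong step (ℕ.pred (m ℕ.∸ k)) ⟩
  applyUpTo (λ i → ℕtoℚ (risingFactorial (suc i) (suc k)) * h (i ℕ.+ suc k)) (ℕ.pred (m ℕ.∸ k))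
    ≡⟨ cong (applyUpTo (λ i → ℕtoℚ (risingFactorial (suc i) (suc k)) * h (i ℕ.+ suc k)))
            (ℕ.pred[m∸n]≡m∸[1+n] m k) ⟩
  applyUpTo (λ i → ℕtoℚ (risingFactorial (suc i) (suc k)) * h (i ℕ.+ suc k)) (m ℕ.∸ suc k) ∎
  where
  open ≡-Reasoning
  step : ∀ i → ℕtoℚ (suc i) * (ℕtoℚ (risingFactorial (suc (suc i)) k) * h (suc i ℕ.+ k)) ≡
               ℕtoℚ (risingFactorial (suc i) (suc k)) * h (i ℕ.+ suc k)
  step i = trans (sym (ℚ.*-assoc (ℕtoℚ (suc i)) (ℕtoℚ (risingFactorial (suc (suc i)) k)) (h (suc i ℕ.+ k))))
    (cong₂ _*_ (trans (sym (ℕtoℚ-* (suc i) (risingFactorial (suc (suc i)) k)))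
                      (cong ℕtoℚ (risingFactorial-suc (suc i) k)))
               (cong h (sym (ℕ.+-suc i k))))

eval-applyUpTo : ∀ (q : ℕ → ℚ) t → eval (applyUpTo q t) (- 1ℚ) ≡ ∑ (upTo t) (λ i → sign i * q i)
eval-applyUpTo q zero    = refl
eval-applyUpTo q (suc t) = trans (cong (λ x → q 0 + (- 1ℚ) * x) (eval-applyUpTo (q ∘ suc) t)) (sym (∑-sign-suc q t))

derivN-at-minus-one : ∀ (h : ℕ → ℚ) m k →
  eval (derivN k (applyUpTo h m)) (- 1ℚ) ≡
  ∑ (upTo (m ℕ.∸ k)) (λ i → sign i * (ℕtoℚ (risingFactorial (suc i) k) * h (i ℕ.+ k)))
derivN-at-minus-one h m k = trans (cong (λ p → eval p (- 1ℚ)) (derivN-applyUpTo h m k)) (eval-applyUpTo _ (m ℕ.∸ k))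

∑-pull-scalars : ∀ {A : Set} (X : List A) (wt : A → ℚ) (g : A → ℕ) s r →
  s * (ℕtoℚ r * ∑ X (λ x → wt x * ℕtoℚ (g x))) ≡ ∑ X (λ x → wt x * (s * ℕtoℚ (r ℕ.* g x)))
∑-pull-scalars X wt g s r = begin
  s * (ℕtoℚ r * ∑ X (λ x → wt x * ℕtoℚ (g x)))     ≡⟨ cong (s *_) (∑-*ˡ X (ℕtoℚ r) _) ⟨
  s * ∑ X (λ x → ℕtoℚ r * (wt x * ℕtoℚ (g x)))     ≡⟨ ∑-*ˡ X s _ ⟨
  ∑ X (λ x → s * (ℕtoℚ r * (wt x * ℕtoℚ (g x))))   ≡⟨ ∑-cong X regroup ⟩
  ∑ X (λ x → wt x * (s * ℕtoℚ (r ℕ.* g x)))        ∎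
  where
  open ≡-Reasoning
  open +-*-Solver using (solve; _:*_; _:=_)
  regroup : ∀ x → s * (ℕtoℚ r * (wt x * ℕtoℚ (g x))) ≡ wt x * (s * ℕtoℚ (r ℕ.* g x))
  regroup x = trans (solve 4 (λ s r w c → s :* (r :* (w :* c)) := w :* (s :* (r :* c))) refl
                           s (ℕtoℚ r) (wt x) (ℕtoℚ (g x)))
                    (cong (λ y → wt x * (s * y)) (sym (ℕtoℚ-* r (g x))))

factorial-cancel : ∀ k w e → w * ℕtoℚ (k ! ℕ.* e) * (ℤ.+ 1 / k !) {{k ℕ.!≢0}} ≡ w * ℕtoℚ e
factorial-cancel k w e = begin
  w * ℕtoℚ (k ! ℕ.* e) * 1/k!         ≡⟨ cong (λ y → w * y * 1/k!) (ℕtoℚ-* (k !) e) ⟩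
  w * (ℕtoℚ (k !) * ℕtoℚ e) * 1/k!    ≡⟨ solve 4 (λ w f e i → w :* (f :* e) :* i := (f :* i) :* (w :* e)) refl
                                                 w (ℕtoℚ (k !)) (ℕtoℚ e) 1/k! ⟩
  (ℕtoℚ (k !) * 1/k!) * (w * ℕtoℚ e)  ≡⟨ cong (_* (w * ℕtoℚ e)) (ℕtoℚ*1/ (k !) {{k ℕ.!≢0}}) ⟩
  1ℚ * (w * ℕtoℚ e)                   ≡⟨ ℚ.*-identityˡ _ ⟩
  w * ℕtoℚ e                          ∎
  where
  open ≡-Reasoning
  open +-*-Solver using (solve; _:*_; _:=_)
  1/k! : ℚ
  1/k! = (ℤ.+ 1 / k !) {{k ℕ.!≢0}}

-- The polynomial below is Σ_x wt x · (1 + y)^(β x).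
taylor-at-minus-one : ∀ {A : Set} (X : List A) (wt : A → ℚ) (β : A → ℕ) m k → (∀ x → β x ℕ.< m) →
  eval (derivN k (applyUpTo (λ j → ∑ X (λ x → wt x * ℕtoℚ (β x C j))) m)) (- 1ℚ) * (ℤ.+ 1 / k !) {{k ℕ.!≢0}} ≡
  ∑ X (λ x → wt x * ℕtoℚ (ℕΣ.𝟙 (β x ℕ.≡ᵇ k)))
taylor-at-minus-one X wt β m k β<m = begin
  eval (derivN k (applyUpTo h m)) (- 1ℚ) * 1/k!
    ≡⟨ cong (_* 1/k!) (derivN-at-minus-one h m k) ⟩
  ∑ (upTo t) (λ i → sign i * (ℕtoℚ (rising i) * h (i ℕ.+ k))) * 1/k!
    ≡⟨ cong (_* 1/k!) (∑-cong (upTo t) (λ i → ∑-pull-scalars X wt (λ x → β x C (i ℕ.+ k)) (sign i) (rising i))) ⟩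
  ∑ (upTo t) (λ i → ∑ X (λ x → wt x * (sign i * ℕtoℚ (rising i ℕ.* (β x C (i ℕ.+ k)))))) * 1/k!
    ≡⟨ cong (_* 1/k!) (∑-comm (upTo t) X _) ⟩
  ∑ X (λ x → ∑ (upTo t) (λ i → wt x * (sign i * ℕtoℚ (rising i ℕ.* (β x C (i ℕ.+ k)))))) * 1/k!
    ≡⟨ cong (_* 1/k!) (∑-cong X (λ x → trans (∑-*ˡ (upTo t) (wt x) _) (cong (wt x *_) (alternating x)))) ⟩
  ∑ X (λ x → wt x * ℕtoℚ (k ! ℕ.* ℕΣ.𝟙 (β x ℕ.≡ᵇ k))) * 1/k!
    ≡⟨ ∑-*ʳ X 1/k! _ ⟨
  ∑ X (λ x → wt x * ℕtoℚ (k ! ℕ.* ℕΣ.𝟙 (β x ℕ.≡ᵇ k)) * 1/k!)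
    ≡⟨ ∑-cong X (λ x → factorial-cancel k (wt x) (ℕΣ.𝟙 (β x ℕ.≡ᵇ k))) ⟩
  ∑ X (λ x → wt x * ℕtoℚ (ℕΣ.𝟙 (β x ℕ.≡ᵇ k))) ∎
  where
  open ≡-Reasoning
  h : ℕ → ℚ
  h j = ∑ X (λ x → wt x * ℕtoℚ (β x C j))
  t : ℕ
  t = m ℕ.∸ k
  1/k! : ℚ
  1/k! = (ℤ.+ 1 / k !) {{k ℕ.!≢0}}
  rising : ℕ → ℕ
  rising i = risingFactorial (suc i) k
  alternating : ∀ x → ∑ (upTo t) (λ i → sign i * ℕtoℚ (rising i ℕ.* (β x C (i ℕ.+ k)))) ≡
                      ℕtoℚ (k ! ℕ.* ℕΣ.𝟙 (β x ℕ.≡ᵇ k))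
  alternating x = alternating-rising k (β x) t (ℕ.<-≤-trans (β<m x) (ℕ.m≤n+m∸n m k))

-- The coefficients of F

module _ {n} (G : Graph (suc n)) where

  private
    Orderings : List (Fin (suc n) → Fin (suc n))
    Orderings = allFuns (suc n) (suc n)

  bad-superset-independent : ∀ {I} π → T (I ⊆ᵇ bad G π) → T (independent G I)
  bad-superset-independent {I} π h =
    independent⁺ G {I} (bad-independent G {π} {I} (λ {v} v∈I → bad⁻ G π v (⊆ᵇ⁻ {I = I} h v∈I)))

  chosen-badOn : ∀ j I π → 𝟙 ((independent G I ∧ (card I ℕ.≡ᵇ j)) ∧ badOnᵇ G I π) ≡
                           𝟙 (isBijection π ∧ ((card I ℕ.≡ᵇ j) ∧ (I ⊆ᵇ bad G π)))
  chosen-badOn j I π = 𝟙-cong forth back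
    where
    forth : T ((independent G I ∧ (card I ℕ.≡ᵇ j)) ∧ badOnᵇ G I π) →
            T (isBijection π ∧ ((card I ℕ.≡ᵇ j) ∧ (I ⊆ᵇ bad G π)))
    forth h = let ((_ , size) , (bij , sub)) = Product.map (∧⁻ {independent G I}) (∧⁻ {isBijection π})
                                                           (∧⁻ {independent G I ∧ (card I ℕ.≡ᵇ j)} h)
              in ∧⁺ bij (∧⁺ size sub)
    back : T (isBijection π ∧ ((card I ℕ.≡ᵇ j) ∧ (I ⊆ᵇ bad G π))) →
           T ((independent G I ∧ (card I ℕ.≡ᵇ j)) ∧ badOnᵇ G I π)
    back h = let (bij , size , sub) = Product.map₂ (∧⁻ {card I ℕ.≡ᵇ j}) (∧⁻ {isBijection π} h)
             in ∧⁺ (∧⁺ (bad-superset-independent {I} π sub) size) (∧⁺ bij sub)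

  subsets-of-bad : ∀ π j →
    ∑ (allSubsets (suc n)) (λ I → 𝟙 ((card I ℕ.≡ᵇ j) ∧ (I ⊆ᵇ bad G π))) ≡ ℕtoℚ (numBad G π C j)
  subsets-of-bad π j = begin
    ∑ (allSubsets (suc n)) (λ I → 𝟙 ((card I ℕ.≡ᵇ j) ∧ (I ⊆ᵇ bad G π)))
      ≡⟨ ∑-cong (allSubsets (suc n)) (λ I → ℕtoℚ-𝟙 ((card I ℕ.≡ᵇ j) ∧ (I ⊆ᵇ bad G π))) ⟨
    ∑ (allSubsets (suc n)) (λ I → ℕtoℚ (ℕΣ.𝟙 ((card I ℕ.≡ᵇ j) ∧ (I ⊆ᵇ bad G π))))
      ≡⟨ ℕtoℚ-∑ (allSubsets (suc n)) _ ⟨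
    ℕtoℚ (ℕΣ.∑ (allSubsets (suc n)) (λ I → ℕΣ.𝟙 ((card I ℕ.≡ᵇ j) ∧ (I ⊆ᵇ bad G π))))
      ≡⟨ cong ℕtoℚ (subsets-of-size (suc n) (bad G π) j) ⟩
    ℕtoℚ (numBad G π C j) ∎
    where open ≡-Reasoning

  coefficient : ∀ j →
    ℕtoℚ (suc n !) * ∑ (allSubsets (suc n)) (λ I → if independent G I ∧ (card I ℕ.≡ᵇ j) then w G I else 0ℚ) ≡
    ∑ Orderings (λ π → 𝟙 (isBijection π) * ℕtoℚ (numBad G π C j))
  coefficient j = begin
    N! * ∑ Subsets (λ I → if chosen I then w G I else 0ℚ)
      ≡⟨ ∑-*ˡ Subsets N! _ ⟨
    ∑ Subsets (λ I → N! * (if chosen I then w G I else 0ℚ))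
      ≡⟨ ∑-cong Subsets weight ⟩
    ∑ Subsets (λ I → 𝟙 (chosen I) * ∑ Orderings (𝟙 ∘ badOnᵇ G I))
      ≡⟨ ∑-cong Subsets (λ I → ∑-*ˡ Orderings (𝟙 (chosen I)) _) ⟨
    ∑ Subsets (λ I → ∑ Orderings (λ π → 𝟙 (chosen I) * 𝟙 (badOnᵇ G I π)))
      ≡⟨ ∑-comm Subsets Orderings _ ⟩
    ∑ Orderings (λ π → ∑ Subsets (λ I → 𝟙 (chosen I) * 𝟙 (badOnᵇ G I π)))
      ≡⟨ ∑-cong Orderings (λ π → ∑-cong Subsets (λ I → factor π I)) ⟩
    ∑ Orderings (λ π → ∑ Subsets (λ I → 𝟙 (isBijection π) * 𝟙 ((card I ℕ.≡ᵇ j) ∧ (I ⊆ᵇ bad G π))))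
      ≡⟨ ∑-cong Orderings (λ π → trans (∑-*ˡ Subsets (𝟙 (isBijection π)) _)
                                       (cong (𝟙 (isBijection π) *_) (subsets-of-bad π j))) ⟩
    ∑ Orderings (λ π → 𝟙 (isBijection π) * ℕtoℚ (numBad G π C j)) ∎
    where
    open ≡-Reasoning
    N! : ℚ
    N! = ℕtoℚ (suc n !)
    Subsets : List (Subset (suc n))
    Subsets = allSubsets (suc n)
    chosen : Subset (suc n) → Bool
    chosen I = independent G I ∧ (card I ℕ.≡ᵇ j)
    weight : ∀ I → N! * (if chosen I then w G I else 0ℚ) ≡ 𝟙 (chosen I) * ∑ Orderings (𝟙 ∘ badOnᵇ G I)
    weight I = begin
      N! * (if chosen I then w G I else 0ℚ)       ≡⟨ cong (N! *_) (if-then-0 (chosen I) (w G I)) ⟩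
      N! * (𝟙 (chosen I) * w G I)                 ≡⟨ ℚ*.x∙yz≈y∙xz N! (𝟙 (chosen I)) (w G I) ⟩
      𝟙 (chosen I) * (N! * w G I)
        ≡⟨ 𝟙-*-cong (chosen I) (λ h → sym (count-badOn G I (independent⁻ G {I} (proj₁ (∧⁻ {independent G I} h))))) ⟩
      𝟙 (chosen I) * ∑ Orderings (𝟙 ∘ badOnᵇ G I) ∎
    factor : ∀ π I → 𝟙 (chosen I) * 𝟙 (badOnᵇ G I π) ≡ 𝟙 (isBijection π) * 𝟙 ((card I ℕ.≡ᵇ j) ∧ (I ⊆ᵇ bad G π))
    factor π I = trans (sym (𝟙-∧ (chosen I) (badOnᵇ G I π))) (trans (chosen-badOn j I π) (𝟙-∧ (isBijection π) _))

  binomialMoment : ℕ → ℚ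
  binomialMoment j = ∑ Orderings (λ π → 𝟙 (isBijection π) * ℕtoℚ (numBad G π C j))

  F-coefficients : F G ≡ applyUpTo binomialMoment (suc (suc n))
  F-coefficients = trans (sym (List.map-∘ (upTo (suc (suc n)))))
    (trans (List.map-upTo _ (suc (suc n))) (applyUpTo-cong coefficient (suc (suc n))))

  A≡∑ : ∀ k → ℕtoℚ (A G k) ≡ ∑ Orderings (λ π → 𝟙 (isBijection π) * ℕtoℚ (ℕΣ.𝟙 (numBad G π ℕ.≡ᵇ k)))
  A≡∑ k = trans (ℕtoℚ-length-filterᵇ _ Orderings) (∑-cong Orderings split)
    where
    split : ∀ π → 𝟙 (isBijection π ∧ (numBad G π ℕ.≡ᵇ k)) ≡ 𝟙 (isBijection π) * ℕtoℚ (ℕΣ.𝟙 (numBad G π ℕ.≡ᵇ k))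
    split π = trans (𝟙-∧ (isBijection π) _) (cong (𝟙 (isBijection π) *_) (sym (ℕtoℚ-𝟙 (numBad G π ℕ.≡ᵇ k))))

  numBad<1+n : ∀ π → numBad G π ℕ.< suc (suc n)
  numBad<1+n π = ℕ.s≤s (countV-≤ (bad G π))

  no-bad≡successive : ∀ π → (numBad G π ℕ.≡ᵇ 0) ≡ successive G π
  no-bad≡successive π = T⇔→≡ (mk⇔ forth back)
    where
    forth : T (numBad G π ℕ.≡ᵇ 0) → T (successive G π)
    forth h = allV⁺ _ (λ v → not⁺ (countV≡0⁻ (bad G π) (ℕ.≡ᵇ⇒≡ _ 0 h) v))
    back : T (successive G π) → T (numBad G π ℕ.≡ᵇ 0)
    back h = ℕ.≡⇒≡ᵇ _ 0 (countV≡0⁺ (bad G π) (λ v → not⁻ (allV⁻ _ h v)))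

  A₀≡σ : A G 0 ≡ σ G
  A₀≡σ = trans (length-filterᵇ _ Orderings)
    (trans (ℕΣ.∑-cong Orderings (λ π → cong (λ b → ℕΣ.𝟙 (isBijection π ∧ b)) (no-bad≡successive π)))
           (sym (length-filterᵇ _ Orderings)))

theorem5p3 : ∀ {n : ℕ} (G : Graph n) → 1 ≤ n →
    (∀ (k : ℕ) → ℕtoℚ (A G k) ≡ rhs G k) × (A G 0 ≡ σ G)
theorem5p3 {suc n} G _ = count-by-bad , A₀≡σ G
  where
  open ≡-Reasoning
  count-by-bad : ∀ k → ℕtoℚ (A G k) ≡ rhs G k
  count-by-bad k = begin
    ℕtoℚ (A G k)
      ≡⟨ A≡∑ G k ⟩
    ∑ (allFuns (suc n) (suc n)) (λ π → 𝟙 (isBijection π) * ℕtoℚ (ℕΣ.𝟙 (numBad G π ℕ.≡ᵇ k)))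
      ≡⟨ taylor-at-minus-one (allFuns (suc n) (suc n)) (𝟙 ∘ isBijection) (numBad G) (suc (suc n)) k (numBad<1+n G) ⟨
    eval (derivN k (applyUpTo (binomialMoment G) (suc (suc n)))) (- 1ℚ) * (ℤ.+ 1 / k !) {{k ℕ.!≢0}}
      ≡⟨ cong (λ p → eval (derivN k p) (- 1ℚ) * (ℤ.+ 1 / k !) {{k ℕ.!≢0}}) (F-coefficients G) ⟨
    rhs G k ∎
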